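{- Let $p\geq 3$. Then $r_p(F_{p-1})=p+1$, and $r_p(F_{t,p-1})=p+1$ for every integer $t\geq p$.
   Context: All graphs are finite, simple and undirected. For a graph $G=(V,E)$ and a positive integer $p$, a set $D\subseteq V$ is a $p$-dominating set if every vertex not in $D$ has at least $p$ neighbours in $D$; $\gamma_p(G)$ is the minimum cardinality of a $p$-dominating set. The $p$-reinforcement number is $r_p(G)=\min\{|B| : B\subseteq E(G^c),\ \gamma_p(G+B)<\gamma_p(G)\}$, where $G^c$ is the complement and $G+B$ is $G$ with the edges of $B$ added; by convention $r_p(G)=0$ if $\gamma_p(G)\leq p$. $F_{p-1}$ is the tree obtained from a path $x_1xx_2$ by attaching $p-1$ new leaves to $x_1$ and $p-1$ new leaves to $x_2$. For $t\geq p$, $F_{t,p-1}$ is the tree obtained from a star $K_{1,t}$ with center $x$ by attaching one new leaf $x_i$ to each of its $t$ leaves and then attaching $p-1$ new leaves to each $x_i$. -}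

module Defs where

open import Data.Bool using (Bool; true; false; _∧_; _∨_; not; if_then_else_)
open import Data.Bool.Properties using (∨-comm)
open import Data.Nat using (ℕ; zero; suc; _+_; _*_; _∸_; _≤_; _<_; _≡ᵇ_; _≤ᵇ_; _<ᵇ_)
open import Data.Fin using (Fin; toℕ)
open import Data.Fin.Subset using (Subset; _∩_; ∣_∣; _∉_)
open import Data.Vec using (tabulate)
open import Data.List using (List; map; allFin)
open import Data.Nat.ListAction using (sum)
open import Data.Product using (Σ; _×_; _,_; ∃-syntax)
open import Relation.Binary.PropositionalEquality using (_≡_; refl; cong; cong₂)

record Graph (n : ℕ) : Set where
  field
    adj    : Fin n → Fin n → Bool
    sym    : ∀ i j → adj i j ≡ adj j i
    irrefl : ∀ i → adj i i ≡ false
open Graph public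

Disjoint : ∀ {n} → Graph n → Graph n → Set
Disjoint B G = ∀ i j → adj B i j ≡ true → adj G i j ≡ false

_⊕_ : ∀ {n} → Graph n → Graph n → Graph n
adj    (G ⊕ B) i j = adj G i j ∨ adj B i j
sym    (G ⊕ B) i j = cong₂ _∨_ (sym G i j) (sym B i j)
irrefl (G ⊕ B) i rewrite irrefl G i | irrefl B i = refl

edgeCount : ∀ {n} → Graph n → ℕ
edgeCount {n} G =
  sum (map (λ i → sum (map (λ j → if (toℕ i <ᵇ toℕ j) ∧ adj G i j then 1 else 0)
                           (allFin n)))
           (allFin n))

N : ∀ {n} → Graph n → Fin n → Subset n
N G v = tabulate (adj G v)

IsPDom : ∀ {n} → ℕ → Graph n → Subset n → Set
IsPDom p G D = ∀ v → v ∉ D → p ≤ ∣ D ∩ N G v ∣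

IsGammaP : ∀ {n} → ℕ → Graph n → ℕ → Set
IsGammaP p G k =
  (Σ (Subset _) λ D → IsPDom p G D × ∣ D ∣ ≡ k) × (∀ D → IsPDom p G D → k ≤ ∣ D ∣)

Reinforcing : ∀ {n} → ℕ → Graph n → Graph n → Set
Reinforcing p G B =
  Disjoint B G × ∃[ k ] ∃[ k' ] (IsGammaP p G k × IsGammaP p (G ⊕ B) k' × k' < k)

-- r_p(G) = r   (with the convention r_p(G) = 0 when γ_p(G) ≤ p)
IsRP : ∀ {n} → ℕ → Graph n → ℕ → Set
IsRP p G r =
  (∀ k → IsGammaP p G k → k ≤ p → r ≡ 0) ×
  (∀ k → IsGammaP p G k → p < k →
     (Σ (Graph _) λ B → Reinforcing p G B × edgeCount B ≡ r) ×
     (∀ B → Reinforcing p G B → r ≤ edgeCount B))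

≡ᵇ-sym : ∀ a b → (a ≡ᵇ b) ≡ (b ≡ᵇ a)
≡ᵇ-sym zero zero = refl
≡ᵇ-sym zero (suc b) = refl
≡ᵇ-sym (suc a) zero = refl
≡ᵇ-sym (suc a) (suc b) = ≡ᵇ-sym a b

≡ᵇ-refl : ∀ a → (a ≡ᵇ a) ≡ true
≡ᵇ-refl zero = refl
≡ᵇ-refl (suc a) = ≡ᵇ-refl a

fromEdges : (n : ℕ) → (ℕ → ℕ → Bool) → Graph n
adj    (fromEdges n e) i j = not (toℕ i ≡ᵇ toℕ j) ∧ (e (toℕ i) (toℕ j) ∨ e (toℕ j) (toℕ i))
sym    (fromEdges n e) i j =
  cong₂ _∧_ (cong not (≡ᵇ-sym (toℕ i) (toℕ j)))
            (∨-comm (e (toℕ i) (toℕ j)) (e (toℕ j) (toℕ i)))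
irrefl (fromEdges n e) i rewrite ≡ᵇ-refl (toℕ i) = refl

inRange : ℕ → ℕ → ℕ → Bool
inRange lo hi b = (lo ≤ᵇ b) ∧ (b ≤ᵇ hi)

-- F_{p-1}: vertices 0 = x, 1 = x₁, 2 = x₂, leaves 3..p+1 on x₁, leaves p+2..2p on x₂
F : (p : ℕ) → Graph (suc (p + p))
F p = fromEdges _ e
  where
  e : ℕ → ℕ → Bool
  e a b = ((a ≡ᵇ 0) ∧ ((b ≡ᵇ 1) ∨ (b ≡ᵇ 2)))
        ∨ ((a ≡ᵇ 1) ∧ inRange 3 (p + 1) b)
        ∨ ((a ≡ᵇ 2) ∧ inRange (p + 2) (p + p) b)

-- F_{t,p-1}: 0 = centre x; 1..t = leaves y_i of K_{1,t}; t+i = x_i attached to y_i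
-- (1 ≤ i ≤ t); x_i = vertex t+i carries the p-1 leaves
-- 2t+1+(i-1)(p-1) .. 2t+i(p-1).
Ft : (t p : ℕ) → Graph (suc (t + t + t * (p ∸ 1)))
Ft t p = fromEdges _ e
  where
  e : ℕ → ℕ → Bool
  e a b = ((a ≡ᵇ 0) ∧ inRange 1 t b)
        ∨ (inRange 1 t a ∧ (b ≡ᵇ a + t))
        ∨ (inRange (t + 1) (t + t) a ∧
             inRange (t + t + 1 + (a ∸ (t + 1)) * (p ∸ 1)) (t + t + (a ∸ t) * (p ∸ 1)) b)

module Submission where

-- If D p-dominates G ⊕ B, the deficit
-- p - |N_G(v) ∩ D| of each vertex v ∉ D must be made up by distinct B-edges
-- between v and D, so the total deficit of D in G is at most |E(B)|
-- (∑deficit≤edgeCount).  For each tree we exhibit a p-dominating set of size γ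
-- (the leaves together with x, resp. with the yᵢ) and show, star by star, that
-- every D with |D| < γ has total deficit ≥ p + 1 (F-arith, Ft-arith).  Taking
-- B = ∅ this shows γ_p = γ, and in general r_p ≥ p + 1; an explicit B₀ with
-- p + 1 edges and a p-dominating set of G ⊕ B₀ of size γ - 1 give r_p ≤ p + 1.
-- The passage from these bounds to IsRP is the general lemma rp-from-bounds.

open import Defs renaming (sym to adj-sym)
open import Data.Nat
open import Data.Nat.Properties
open import Data.Nat.Tactic.RingSolver using (solve-∀)
import Data.Nat.ListAction as ListAction
import Algebra.Properties.CommutativeSemigroup as CS
open import Data.Bool using (Bool; true; false; _∧_; _∨_; not; T; if_then_else_)
open import Data.Bool.Properties using (∨-identityʳ; ∨-conicalˡ; ∨-conicalʳ; ¬-not)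
open import Data.Fin using (Fin; zero; suc; toℕ; fromℕ<)
open import Data.Fin.Properties using (toℕ-injective; toℕ-fromℕ<; all?)
open import Data.Fin.Subset using (Subset; _∩_; ∣_∣; _∉_; ⊤)
open import Data.Fin.Subset.Properties using (_∈?_; ∈⊤; anySubset?; ∣p∣≤n)
open import Data.Vec using ([]; _∷_; lookup; tabulate)
open import Data.Vec.Properties using (lookup-zipWith; lookup∘tabulate; lookup⇒[]=; []=⇒lookup; tabulate-cong)
import Data.List as List
open import Data.List.Properties using (map-tabulate)
open import Data.Product using (Σ; _×_; _,_; ∃-syntax; proj₁; proj₂)
open import Data.Sum using (_⊎_; inj₁; inj₂; swap)
open import Data.Empty using (⊥; ⊥-elim)
open import Relation.Nullary using (Dec; yes; no; ¬_)
open import Relation.Nullary.Decidable using (_→-dec_; _×-dec_; ¬?)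
open import Relation.Binary.PropositionalEquality
open import Function using (_∘′_)
open import Relation.Binary.Definitions using (tri<; tri≈; tri>)
open import Algebra.Properties.CommutativeMonoid.Sum +-0-commutativeMonoid
  using (sum-syntax; sum-cong-≗; ∑-distrib-+; ∑-comm; sum-replicate-zero)
open import Algebra.Properties.Semiring.Sum +-*-semiring using (*-distribˡ-sum)

bit : Bool → ℕ
bit true = 1
bit false = 0

bit≤1 : ∀ b → bit b ≤ 1
bit≤1 true = s≤s z≤n
bit≤1 false = z≤n

bit-∧ : ∀ a b → bit (a ∧ b) ≡ bit a * bit b
bit-∧ true b = sym (+-identityʳ (bit b))
bit-∧ false b = refl

bit-mono : ∀ {x y} → (x ≡ true → y ≡ true) → bit x ≤ bit y
bit-mono {false} h = z≤n
bit-mono {true} h rewrite h refl = s≤s z≤n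

∨-true : ∀ a b → a ∨ b ≡ true → a ≡ true ⊎ b ≡ true
∨-true true b _ = inj₁ refl
∨-true false b h = inj₂ h

∧-true : ∀ a b → a ∧ b ≡ true → a ≡ true × b ≡ true
∧-true true true _ = refl , refl

∨-introˡ : ∀ {a} b → a ≡ true → a ∨ b ≡ true
∨-introˡ b refl = refl

∨-introʳ : ∀ a {b} → b ≡ true → a ∨ b ≡ true
∨-introʳ true refl = refl
∨-introʳ false refl = refl

∧-intro : ∀ {a b} → a ≡ true → b ≡ true → a ∧ b ≡ true
∧-intro refl refl = refl

∨-false : ∀ {a b} → a ∨ b ≡ false → a ≡ false × b ≡ false
∨-false {a} {b} h = ∨-conicalˡ a b h , ∨-conicalʳ a b h

true≢false : ∀ {b} → b ≡ true → b ≡ false → ⊥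
true≢false refl ()

T⇒≡ : ∀ {b} → T b → b ≡ true
T⇒≡ {true} _ = refl

≡⇒T : ∀ {b} → b ≡ true → T b
≡⇒T refl = _

≡ᵇ-true : ∀ a b → (a ≡ᵇ b) ≡ true → a ≡ b
≡ᵇ-true a b h = ≡ᵇ⇒≡ a b (≡⇒T h)

≡ᵇ-intro : ∀ a b → a ≡ b → (a ≡ᵇ b) ≡ true
≡ᵇ-intro a b e = T⇒≡ (≡⇒≡ᵇ a b e)

≤ᵇ-true : ∀ a b → (a ≤ᵇ b) ≡ true → a ≤ b
≤ᵇ-true a b h = ≤ᵇ⇒≤ a b (≡⇒T h)

≤ᵇ-intro : ∀ {a b} → a ≤ b → (a ≤ᵇ b) ≡ true
≤ᵇ-intro h = T⇒≡ (≤⇒≤ᵇ h)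

≤ᵇ-false : ∀ a b → ¬ (a ≤ b) → (a ≤ᵇ b) ≡ false
≤ᵇ-false a b nle = ¬-not (λ h → nle (≤ᵇ-true a b h))

inRange-true : ∀ lo hi b → inRange lo hi b ≡ true → lo ≤ b × b ≤ hi
inRange-true lo hi b h with ∧-true (lo ≤ᵇ b) (b ≤ᵇ hi) h
... | h1 , h2 = ≤ᵇ-true lo b h1 , ≤ᵇ-true b hi h2

inRange-intro : ∀ lo hi b → lo ≤ b → b ≤ hi → inRange lo hi b ≡ true
inRange-intro lo hi b h1 h2 = ∧-intro (≤ᵇ-intro h1) (≤ᵇ-intro h2)

inRange-above : ∀ lo hi b → hi < b → inRange lo hi b ≡ false
inRange-above lo hi b h = ¬-not (λ e → <⇒≱ h (proj₂ (inRange-true lo hi b e)))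

≤1-cases : ∀ {x} → x ≤ 1 → x ≡ 0 ⊎ x ≡ 1
≤1-cases z≤n = inj₁ refl
≤1-cases (s≤s z≤n) = inj₂ refl

1≤+-split : ∀ x y → 1 ≤ x + y → 1 ≤ x ⊎ 1 ≤ y
1≤+-split zero y h = inj₂ h
1≤+-split (suc x) y h = inj₁ (s≤s z≤n)

+-interchange : ∀ a b c d → (a + b) + (c + d) ≡ (a + c) + (b + d)
+-interchange = CS.interchange +-commutativeSemigroup

≢-via : ∀ {a b x y : ℕ} → a ≡ x → b ≡ y → x ≢ y → a ≢ b
≢-via refl refl ne = ne

≤-by : ∀ {a b} r → a ≡ b + r → b ≤ a
≤-by {a} {b} r e = subst (b ≤_) (sym e) (m≤m+n b r)

-- Sums over a range of naturals: ∑ℕ n f = f 0 + … + f (n - 1).  The concrete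
-- graphs number their vertices by naturals, so vertex classes are ranges.

∑ℕ : ℕ → (ℕ → ℕ) → ℕ
∑ℕ zero f = 0
∑ℕ (suc n) f = f 0 + ∑ℕ n (λ k → f (suc k))

∑ℕ-cong : ∀ n {f g : ℕ → ℕ} → (∀ k → k < n → f k ≡ g k) → ∑ℕ n f ≡ ∑ℕ n g
∑ℕ-cong zero h = refl
∑ℕ-cong (suc n) h = cong₂ _+_ (h 0 (s≤s z≤n)) (∑ℕ-cong n (λ k k<n → h (suc k) (s≤s k<n)))

∑ℕ-mono : ∀ n {f g : ℕ → ℕ} → (∀ k → k < n → f k ≤ g k) → ∑ℕ n f ≤ ∑ℕ n g
∑ℕ-mono zero h = z≤n
∑ℕ-mono (suc n) h = +-mono-≤ (h 0 (s≤s z≤n)) (∑ℕ-mono n (λ k k<n → h (suc k) (s≤s k<n)))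

∑ℕ-mono-< : ∀ n {f g : ℕ → ℕ} a → (∀ k → k < n → f k ≤ g k) → a < n → f a < g a → ∑ℕ n f < ∑ℕ n g
∑ℕ-mono-< (suc n) zero h _ lt = +-mono-<-≤ lt (∑ℕ-mono n (λ k k<n → h (suc k) (s≤s k<n)))
∑ℕ-mono-< (suc n) (suc a) h (s≤s a<n) lt =
  +-mono-≤-< (h 0 (s≤s z≤n)) (∑ℕ-mono-< n a (λ k k<n → h (suc k) (s≤s k<n)) a<n lt)

∑ℕ-+ : ∀ n (f g : ℕ → ℕ) → ∑ℕ n (λ k → f k + g k) ≡ ∑ℕ n f + ∑ℕ n g
∑ℕ-+ zero f g = refl
∑ℕ-+ (suc n) f g =
  trans (cong (f 0 + g 0 +_) (∑ℕ-+ n (λ k → f (suc k)) (λ k → g (suc k)))) (+-interchange (f 0) (g 0) _ _)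

∑ℕ-split : ∀ a b (f : ℕ → ℕ) → ∑ℕ (a + b) f ≡ ∑ℕ a f + ∑ℕ b (λ k → f (a + k))
∑ℕ-split zero b f = refl
∑ℕ-split (suc a) b f = trans (cong (f 0 +_) (∑ℕ-split a b (λ k → f (suc k)))) (sym (+-assoc (f 0) _ _))

∑ℕ-*ˡ : ∀ n c (f : ℕ → ℕ) → ∑ℕ n (λ k → c * f k) ≡ c * ∑ℕ n f
∑ℕ-*ˡ zero c f = sym (*-zeroʳ c)
∑ℕ-*ˡ (suc n) c f = trans (cong (c * f 0 +_) (∑ℕ-*ˡ n c (λ k → f (suc k)))) (sym (*-distribˡ-+ c (f 0) _))

∑ℕ-*ʳ : ∀ n c (f : ℕ → ℕ) → ∑ℕ n (λ k → f k * c) ≡ ∑ℕ n f * c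
∑ℕ-*ʳ n c f = trans (∑ℕ-cong n (λ k _ → *-comm (f k) c)) (trans (∑ℕ-*ˡ n c f) (*-comm c _))

∑ℕ-zero : ∀ n (f : ℕ → ℕ) → (∀ k → k < n → f k ≡ 0) → ∑ℕ n f ≡ 0
∑ℕ-zero zero f h = refl
∑ℕ-zero (suc n) f h rewrite h 0 (s≤s z≤n) = ∑ℕ-zero n _ (λ k k<n → h (suc k) (s≤s k<n))

∑ℕ-const : ∀ n c → ∑ℕ n (λ _ → c) ≡ n * c
∑ℕ-const zero c = refl
∑ℕ-const (suc n) c = cong (c +_) (∑ℕ-const n c)

∑ℕ-ones : ∀ n (f : ℕ → ℕ) → (∀ k → k < n → f k ≡ 1) → ∑ℕ n f ≡ n
∑ℕ-ones n f h = trans (∑ℕ-cong n h) (trans (∑ℕ-const n 1) (*-identityʳ n))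

∑ℕ-blocks : ∀ t m (f : ℕ → ℕ) → ∑ℕ (t * m) f ≡ ∑ℕ t (λ i → ∑ℕ m (λ k → f (i * m + k)))
∑ℕ-blocks zero m f = refl
∑ℕ-blocks (suc t) m f =
  trans (∑ℕ-split m (t * m) f)
        (cong (∑ℕ m f +_)
          (trans (∑ℕ-blocks t m (λ k → f (m + k)))
                 (∑ℕ-cong t (λ i _ → ∑ℕ-cong m (λ k _ → cong f (sym (+-assoc m (i * m) k)))))))

∑ℕ-term : ∀ n (f : ℕ → ℕ) i → i < n → f i ≤ ∑ℕ n f
∑ℕ-term (suc n) f zero _ = m≤m+n (f 0) _
∑ℕ-term (suc n) f (suc i) (s≤s i<n) = ≤-trans (∑ℕ-term n (λ k → f (suc k)) i i<n) (m≤n+m _ (f 0))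

∑ℕ-pigeonhole : ∀ t P (s : ℕ → ℕ) → ∑ℕ t s < t * P → ∃[ i ] (i < t × s i < P)
∑ℕ-pigeonhole (suc t) P s h with s 0 <? P
... | yes lt = 0 , s≤s z≤n , lt
... | no nlt with ∑ℕ-pigeonhole t P (λ k → s (suc k))
                  (+-cancelˡ-< P _ _ (≤-trans (s≤s (+-monoˡ-≤ (∑ℕ t (λ k → s (suc k))) (≮⇒≥ nlt))) h))
...   | i , i<t , si = suc i , s≤s i<t , si

∑ℕ-complement : ∀ n (c : ℕ → ℕ) → (∀ k → c k ≤ 1) → ∀ a →
  ∑ℕ n (λ k → 1 ∸ c (a + k)) + ∑ℕ n (λ k → c (a + k)) ≡ n
∑ℕ-complement n c h a =
  trans (sym (∑ℕ-+ n (λ k → 1 ∸ c (a + k)) (λ k → c (a + k))))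
        (∑ℕ-ones n _ (λ k _ → m∸n+n≡m (h (a + k))))

-- Range indicators: ind lo len k = 1 exactly when lo ≤ k < lo + len.

ind : ℕ → ℕ → ℕ → ℕ
ind zero zero k = 0
ind zero (suc len) zero = 1
ind zero (suc len) (suc k) = ind zero len k
ind (suc lo) len zero = 0
ind (suc lo) len (suc k) = ind lo len k

ind≤1 : ∀ lo len k → ind lo len k ≤ 1
ind≤1 zero zero k = z≤n
ind≤1 zero (suc len) zero = s≤s z≤n
ind≤1 zero (suc len) (suc k) = ind≤1 zero len k
ind≤1 (suc lo) len zero = z≤n
ind≤1 (suc lo) len (suc k) = ind≤1 lo len k

ind-in : ∀ lo len k → lo ≤ k → k < lo + len → ind lo len k ≡ 1
ind-in zero zero k _ ()
ind-in zero (suc len) zero _ _ = refl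
ind-in zero (suc len) (suc k) _ (s≤s h) = ind-in zero len k z≤n h
ind-in (suc lo) len (suc k) (s≤s a) (s≤s b) = ind-in lo len k a b

ind-at : ∀ a → ind a 1 a ≡ 1
ind-at a = ind-in a 1 a ≤-refl (≤-reflexive (+-comm 1 a))

ind-pos : ∀ lo len k → 1 ≤ ind lo len k → lo ≤ k × k < lo + len
ind-pos zero (suc len) zero _ = z≤n , s≤s z≤n
ind-pos zero (suc len) (suc k) h with ind-pos zero len k h
... | _ , b = z≤n , s≤s b
ind-pos (suc lo) len (suc k) h with ind-pos lo len k h
... | a , b = s≤s a , s≤s b

ind-below : ∀ lo len k → k < lo → ind lo len k ≡ 0
ind-below (suc lo) len zero _ = refl
ind-below (suc lo) len (suc k) (s≤s h) = ind-below lo len k h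

ind-disjoint : ∀ a l₁ b l₂ k → a + l₁ ≤ b → ind a l₁ k + ind b l₂ k ≤ 1
ind-disjoint a l₁ b l₂ k h with ≤1-cases (ind≤1 a l₁ k)
... | inj₁ e rewrite e = ind≤1 b l₂ k
... | inj₂ e rewrite e | ind-below b l₂ k (≤-trans (proj₂ (ind-pos a l₁ k (≤-reflexive (sym e)))) h) = s≤s z≤n

∑ℕ-range : ∀ n lo len (f : ℕ → ℕ) → lo + len ≤ n → ∑ℕ n (λ k → f k * ind lo len k) ≡ ∑ℕ len (λ k → f (lo + k))
∑ℕ-range n zero zero f h = ∑ℕ-zero n _ (λ k _ → *-zeroʳ (f k))
∑ℕ-range (suc n) zero (suc len) f (s≤s h) =
  cong₂ _+_ (*-identityʳ (f 0)) (∑ℕ-range n zero len (λ k → f (suc k)) h)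
∑ℕ-range (suc n) (suc lo) len f (s≤s h) =
  cong₂ _+_ (*-zeroʳ (f 0)) (∑ℕ-range n lo len (λ k → f (suc k)) h)

∑ℕ-point : ∀ n a (f : ℕ → ℕ) → a < n → ∑ℕ n (λ k → f k * ind a 1 k) ≡ f a
∑ℕ-point n a f h =
  trans (∑ℕ-range n a 1 f (subst (_≤ n) (+-comm 1 a) h)) (trans (+-identityʳ _) (cong f (+-identityʳ a)))

∑ℕ-ind : ∀ n a len → a + len ≤ n → ∑ℕ n (ind a len) ≡ len
∑ℕ-ind n a len h =
  trans (∑ℕ-cong n (λ k _ → sym (*-identityˡ (ind a len k))))
        (trans (∑ℕ-range n a len (λ _ → 1) h) (∑ℕ-ones len _ (λ _ _ → refl)))

∑ℕ-*-+ : ∀ n (c I J : ℕ → ℕ) → ∑ℕ n (λ u → c u * (I u + J u)) ≡ ∑ℕ n (λ u → c u * I u) + ∑ℕ n (λ u → c u * J u)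
∑ℕ-*-+ n c I J = trans (∑ℕ-cong n (λ u _ → *-distribˡ-+ (c u) (I u) (J u))) (∑ℕ-+ n _ _)

∑-cong : ∀ n {f g : Fin n → ℕ} → (∀ j → f j ≡ g j) → ∑[ j < n ] f j ≡ ∑[ j < n ] g j
∑-cong n h = sum-cong-≗ {n} h

∑-mono : ∀ n {f g : Fin n → ℕ} → (∀ j → f j ≤ g j) → ∑[ j < n ] f j ≤ ∑[ j < n ] g j
∑-mono zero h = z≤n
∑-mono (suc n) h = +-mono-≤ (h zero) (∑-mono n (λ j → h (suc j)))

∑-*ˡ : ∀ n c (f : Fin n → ℕ) → ∑[ j < n ] (c * f j) ≡ c * ∑[ j < n ] f j
∑-*ˡ n c f = sym (*-distribˡ-sum {n} c f)

∑-zero : ∀ n (f : Fin n → ℕ) → (∀ j → f j ≡ 0) → ∑[ j < n ] f j ≡ 0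
∑-zero n f h = trans (∑-cong n h) (sum-replicate-zero n)

∑-toℕ : ∀ n (h : ℕ → ℕ) → ∑[ j < n ] h (toℕ j) ≡ ∑ℕ n h
∑-toℕ zero h = refl
∑-toℕ (suc n) h = cong (h 0 +_) (∑-toℕ n (λ k → h (suc k)))

∑-allFin : ∀ n (f : Fin n → ℕ) → ListAction.sum (List.map f (List.allFin n)) ≡ ∑[ j < n ] f j
∑-allFin n f = trans (cong ListAction.sum (map-tabulate (λ x → x) f)) (sum-tabulate n f)
  where
  sum-tabulate : ∀ n (f : Fin n → ℕ) → ListAction.sum (List.tabulate f) ≡ ∑[ j < n ] f j
  sum-tabulate zero f = refl
  sum-tabulate (suc n) f = cong (f zero +_) (sum-tabulate n (λ j → f (suc j)))

extend : ∀ {n} → (Fin n → ℕ) → ℕ → ℕ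
extend {zero} g v = 0
extend {suc n} g zero = g zero
extend {suc n} g (suc v) = extend (λ j → g (suc j)) v

∑≡∑ℕ-extend : ∀ n (g : Fin n → ℕ) → ∑[ j < n ] g j ≡ ∑ℕ n (extend g)
∑≡∑ℕ-extend zero g = refl
∑≡∑ℕ-extend (suc n) g = cong (g zero +_) (∑≡∑ℕ-extend n (λ j → g (suc j)))

extend-toℕ : ∀ {n} (g : Fin n → ℕ) (w : Fin n) → extend g (toℕ w) ≡ g w
extend-toℕ {suc n} g zero = refl
extend-toℕ {suc n} g (suc w) = extend-toℕ (λ j → g (suc j)) w

extend-cong : ∀ {n} {f g : Fin n → ℕ} → (∀ j → f j ≡ g j) → ∀ v → extend f v ≡ extend g v
extend-cong {zero} h v = refl
extend-cong {suc n} h zero = h zero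
extend-cong {suc n} h (suc v) = extend-cong {n} (λ j → h (suc j)) v

extend-toℕ-fun : ∀ {n} (h : ℕ → ℕ) v → v < n → extend {n} (λ j → h (toℕ j)) v ≡ h v
extend-toℕ-fun {suc n} h zero _ = refl
extend-toℕ-fun {suc n} h (suc v) (s≤s v<n) = extend-toℕ-fun {n} (λ k → h (suc k)) v v<n

extend≤1 : ∀ {n} (g : Fin n → ℕ) → (∀ j → g j ≤ 1) → ∀ v → extend g v ≤ 1
extend≤1 {zero} g h v = z≤n
extend≤1 {suc n} g h zero = h zero
extend≤1 {suc n} g h (suc v) = extend≤1 (λ j → g (suc j)) (λ j → h (suc j)) v

∣∣≡∑ : ∀ {n} (X : Subset n) → ∣ X ∣ ≡ ∑[ j < n ] bit (lookup X j)
∣∣≡∑ [] = refl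
∣∣≡∑ (true ∷ X) = cong suc (∣∣≡∑ X)
∣∣≡∑ (false ∷ X) = ∣∣≡∑ X

∣∩∣≡∑ : ∀ {n} (D : Subset n) (f : Fin n → Bool) → ∣ D ∩ tabulate f ∣ ≡ ∑[ j < n ] bit (lookup D j ∧ f j)
∣∩∣≡∑ {n} D f =
  trans (∣∣≡∑ (D ∩ tabulate f))
        (∑-cong n (λ j → cong bit (trans (lookup-zipWith _∧_ j D (tabulate f)) (cong (lookup D j ∧_) (lookup∘tabulate f j)))))

χ : ∀ {n} → Subset n → ℕ → ℕ
χ D = extend (λ j → bit (lookup D j))

χ≤1 : ∀ {n} (D : Subset n) v → χ D v ≤ 1
χ≤1 D = extend≤1 _ (λ j → bit≤1 (lookup D j))

χ-toℕ : ∀ {n} (D : Subset n) w → χ D (toℕ w) ≡ bit (lookup D w)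
χ-toℕ D = extend-toℕ (λ j → bit (lookup D j))

∣∣≡∑ℕχ : ∀ {n} (D : Subset n) → ∣ D ∣ ≡ ∑ℕ n (χ D)
∣∣≡∑ℕχ {n} D = trans (∣∣≡∑ D) (∑≡∑ℕ-extend n _)

χ-tabulate : ∀ {n} (P : ℕ → Bool) v → v < n → χ (tabulate {n = n} (λ j → P (toℕ j))) v ≡ bit (P v)
χ-tabulate {n} P v v<n =
  trans (extend-cong {n} (λ j → cong bit (lookup∘tabulate (λ j → P (toℕ j)) j)) v)
        (extend-toℕ-fun {n} (λ k → bit (P k)) v v<n)

∉⇒lookup : ∀ {n} (D : Subset n) v → v ∉ D → lookup D v ≡ false
∉⇒lookup D v v∉ = ¬-not (λ e → v∉ (lookup⇒[]= v D e))

lookup⇒∉ : ∀ {n} (D : Subset n) v → lookup D v ≡ false → v ∉ D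
lookup⇒∉ D v e v∈ = true≢false ([]=⇒lookup v∈) e

-- Counting edges.  edgeCount counts the pairs i < j; summing a symmetric
-- quantity over ordered pairs counts every edge twice, once from each end.

ordered : ∀ {n} → Fin n → Fin n → ℕ
ordered i j = bit (toℕ i <ᵇ toℕ j)

ordered-sym≤1 : ∀ {n} (i j : Fin n) → ordered i j + ordered j i ≤ 1
ordered-sym≤1 i j with toℕ i <ᵇ toℕ j in e₁ | toℕ j <ᵇ toℕ i in e₂
... | false | false = z≤n
... | false | true = s≤s z≤n
... | true | false = s≤s z≤n
... | true | true = ⊥-elim (<-asym (<ᵇ⇒< (toℕ i) (toℕ j) (≡⇒T e₁)) (<ᵇ⇒< (toℕ j) (toℕ i) (≡⇒T e₂)))

ordered-sym≡1 : ∀ {n} (i j : Fin n) → toℕ i ≢ toℕ j → ordered i j + ordered j i ≡ 1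
ordered-sym≡1 i j ne with <-cmp (toℕ i) (toℕ j)
... | tri< a _ _ rewrite T⇒≡ (<⇒<ᵇ a) | ¬-not (λ e → <-asym a (<ᵇ⇒< _ _ (≡⇒T e))) = refl
... | tri≈ _ e _ = ⊥-elim (ne e)
... | tri> _ _ c rewrite T⇒≡ (<⇒<ᵇ c) | ¬-not (λ e → <-asym c (<ᵇ⇒< _ _ (≡⇒T e))) = refl

edgeCount≡∑ : ∀ {n} (B : Graph n) → edgeCount B ≡ ∑[ i < n ] ∑[ j < n ] (ordered i j * bit (adj B i j))
edgeCount≡∑ {n} B =
  trans (∑-allFin n _) (∑-cong n (λ i → trans (∑-allFin n _)
    (∑-cong n (λ j → trans (if-bit ((toℕ i <ᵇ toℕ j) ∧ adj B i j)) (bit-∧ (toℕ i <ᵇ toℕ j) (adj B i j))))))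
  where
  if-bit : ∀ b → (if b then 1 else 0) ≡ bit b
  if-bit true = refl
  if-bit false = refl

∑-ordered-symmetrise : ∀ {n} (k : Fin n → Fin n → ℕ) →
  ∑[ i < n ] ∑[ j < n ] (ordered i j * (k i j + k j i)) ≡ ∑[ i < n ] ∑[ j < n ] ((ordered i j + ordered j i) * k i j)
∑-ordered-symmetrise {n} k = begin
    ∑[ i < n ] ∑[ j < n ] (ordered i j * (k i j + k j i))
  ≡⟨ ∑-cong n (λ i → trans (∑-cong n (λ j → *-distribˡ-+ (ordered i j) (k i j) (k j i))) (∑-distrib-+ {n} _ _)) ⟩
    ∑[ i < n ] (∑[ j < n ] (ordered i j * k i j) + ∑[ j < n ] (ordered i j * k j i))
  ≡⟨ ∑-distrib-+ {n} _ _ ⟩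
    ∑[ i < n ] ∑[ j < n ] (ordered i j * k i j) + ∑[ i < n ] ∑[ j < n ] (ordered i j * k j i)
  ≡⟨ cong (∑[ i < n ] ∑[ j < n ] (ordered i j * k i j) +_) (∑-comm {n} {n} (λ i j → ordered i j * k j i)) ⟩
    ∑[ i < n ] ∑[ j < n ] (ordered i j * k i j) + ∑[ i < n ] ∑[ j < n ] (ordered j i * k i j)
  ≡⟨ sym (∑-distrib-+ {n} _ _) ⟩
    ∑[ i < n ] (∑[ j < n ] (ordered i j * k i j) + ∑[ j < n ] (ordered j i * k i j))
  ≡⟨ ∑-cong n (λ i → trans (sym (∑-distrib-+ {n} _ _)) (∑-cong n (λ j → sym (*-distribʳ-+ (k i j) (ordered i j) (ordered j i))))) ⟩
    ∑[ i < n ] ∑[ j < n ] ((ordered i j + ordered j i) * k i j)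
  ∎ where open ≡-Reasoning

adj⇒≢ : ∀ {n} (B : Graph n) i j → adj B i j ≡ true → toℕ i ≢ toℕ j
adj⇒≢ B i j a e with toℕ-injective e
... | refl = true≢false a (irrefl B i)

cut≤edgeCount : ∀ {n} (B : Graph n) (D : Subset n) →
  ∑[ i < n ] (bit (not (lookup D i)) * ∑[ j < n ] bit (lookup D j ∧ adj B i j)) ≤ edgeCount B
cut≤edgeCount {n} B D = begin
    ∑[ i < n ] (bit (not (lookup D i)) * ∑[ j < n ] bit (lookup D j ∧ adj B i j))
  ≡⟨ ∑-cong n (λ i → trans (sym (∑-*ˡ n (bit (not (lookup D i))) _)) (∑-cong n (λ j → sym (bit-∧ (not (lookup D i)) _)))) ⟩
    ∑[ i < n ] ∑[ j < n ] h i j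
  ≡⟨ ∑-cong n (λ i → ∑-cong n (λ j → h-on-edges i j)) ⟩
    ∑[ i < n ] ∑[ j < n ] ((ordered i j + ordered j i) * h i j)
  ≡⟨ sym (∑-ordered-symmetrise h) ⟩
    ∑[ i < n ] ∑[ j < n ] (ordered i j * (h i j + h j i))
  ≤⟨ ∑-mono n (λ i → ∑-mono n (λ j → *-monoʳ-≤ (ordered i j) (one-side i j))) ⟩
    ∑[ i < n ] ∑[ j < n ] (ordered i j * bit (adj B i j))
  ≡⟨ sym (edgeCount≡∑ B) ⟩
    edgeCount B
  ∎ where
  open ≤-Reasoning
  h : Fin n → Fin n → ℕ
  h i j = bit (not (lookup D i) ∧ (lookup D j ∧ adj B i j))
  ∧∧false : ∀ a b → (a ∧ (b ∧ false)) ≡ false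
  ∧∧false true true = refl
  ∧∧false true false = refl
  ∧∧false false b = refl
  h-on-edges : ∀ i j → h i j ≡ (ordered i j + ordered j i) * h i j
  h-on-edges i j with adj B i j in e
  ... | true rewrite ordered-sym≡1 i j (adj⇒≢ B i j e) = sym (+-identityʳ _)
  ... | false rewrite ∧∧false (not (lookup D i)) (lookup D j) = sym (*-zeroʳ (ordered i j + ordered j i))
  crossing : ∀ di dj a → bit (not di ∧ (dj ∧ a)) + bit (not dj ∧ (di ∧ a)) ≤ bit a
  crossing true true true = z≤n
  crossing true false true = s≤s z≤n
  crossing false true true = s≤s z≤n
  crossing false false true = z≤n
  crossing di dj false rewrite ∧∧false (not di) dj | ∧∧false (not dj) di = z≤n
  one-side : ∀ i j → h i j + h j i ≤ bit (adj B i j)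
  one-side i j = subst (λ x → h i j + bit (not (lookup D j) ∧ (lookup D i ∧ x)) ≤ bit (adj B i j))
                       (adj-sym B i j) (crossing (lookup D i) (lookup D j) (adj B i j))

edgeCount≤cover : ∀ {n} (B : Graph n) (C : Fin n → Bool) → (∀ i j → adj B i j ≡ true → C i ∨ C j ≡ true) →
  edgeCount B ≤ ∑[ i < n ] ∑[ j < n ] bit (C i ∧ adj B i j)
edgeCount≤cover {n} B C cov = begin
    edgeCount B
  ≡⟨ edgeCount≡∑ B ⟩
    ∑[ i < n ] ∑[ j < n ] (ordered i j * bit (adj B i j))
  ≤⟨ ∑-mono n (λ i → ∑-mono n (λ j → *-monoʳ-≤ (ordered i j) (covered i j))) ⟩
    ∑[ i < n ] ∑[ j < n ] (ordered i j * (k i j + k j i))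
  ≡⟨ ∑-ordered-symmetrise k ⟩
    ∑[ i < n ] ∑[ j < n ] ((ordered i j + ordered j i) * k i j)
  ≤⟨ ∑-mono n (λ i → ∑-mono n (λ j → ≤-trans (*-monoˡ-≤ (k i j) (ordered-sym≤1 i j)) (≤-reflexive (+-identityʳ _)))) ⟩
    ∑[ i < n ] ∑[ j < n ] k i j
  ∎ where
  open ≤-Reasoning
  k : Fin n → Fin n → ℕ
  k i j = bit (C i ∧ adj B i j)
  one-end : ∀ ci cj a → (a ≡ true → ci ∨ cj ≡ true) → bit a ≤ bit (ci ∧ a) + bit (cj ∧ a)
  one-end ci cj false h = z≤n
  one-end true cj true h = s≤s z≤n
  one-end false true true h = s≤s z≤n
  one-end false false true h with h refl
  ... | ()
  covered : ∀ i j → bit (adj B i j) ≤ k i j + k j i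
  covered i j = subst (λ x → bit (adj B i j) ≤ k i j + bit (C j ∧ x)) (adj-sym B i j)
                      (one-end (C i) (C j) (adj B i j) (cov i j))

-- p-domination is decidable, so γ_p exists: starting from D = ⊤, shrink D while a
-- smaller p-dominating set exists.
isPDom? : ∀ {n} p (G : Graph n) D → Dec (IsPDom p G D)
isPDom? p G D = all? (λ v → (¬? (v ∈? D)) →-dec (p ≤? ∣ D ∩ N G v ∣))

γ-exists : ∀ {n} p (G : Graph n) → ∃[ k ] IsGammaP p G k
γ-exists {n} p G = descend n (⊤ , (λ v v∉ → ⊥-elim (v∉ ∈⊤)) , ∣p∣≤n ⊤)
  where
  descend : ∀ m → (Σ (Subset n) λ D → IsPDom p G D × ∣ D ∣ ≤ m) → ∃[ k ] IsGammaP p G k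
  descend zero (D , pd , le) = 0 , (D , pd , n≤0⇒n≡0 le) , (λ _ _ → z≤n)
  descend (suc m) (D , pd , le) with anySubset? (λ D' → isPDom? p G D' ×-dec (∣ D' ∣ ≤? m))
  ... | yes (D' , pd' , le') = descend m (D' , pd' , le')
  ... | no none = suc m , (D , pd , ≤-antisym le (≰⇒> (λ le' → none (D , pd , le')))) ,
                  (λ D' pd' → ≰⇒> (λ le' → none (D' , pd' , le')))

emptyGraph : ∀ {n} → Graph n
adj emptyGraph _ _ = false
adj-sym emptyGraph _ _ = refl
irrefl emptyGraph _ = refl

edgeCount-empty : ∀ {n} → edgeCount (emptyGraph {n}) ≡ 0
edgeCount-empty {n} =
  trans (edgeCount≡∑ (emptyGraph {n}))
        (∑-zero n _ (λ i → ∑-zero n _ (λ j → *-zeroʳ (ordered i j))))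

isPDom-⊕empty : ∀ {n} p (G : Graph n) D → IsPDom p G D → IsPDom p (G ⊕ emptyGraph) D
isPDom-⊕empty p G D pd v v∉ =
  subst (λ X → p ≤ ∣ D ∩ X ∣) (sym (tabulate-cong (λ j → ∨-identityʳ (adj G v j)))) (pd v v∉)

deficit : ∀ {n} → ℕ → Graph n → Subset n → Fin n → ℕ
deficit {n} p G D v = bit (not (lookup D v)) * (p ∸ ∑[ j < n ] bit (lookup D j ∧ adj G v j))

-- Deficit bound: if D p-dominates G ⊕ B, the deficits of D in G are paid for by
-- B-edges into D, so their total is at most |E(B)|.
∑deficit≤edgeCount : ∀ {n} p (G B : Graph n) D → IsPDom p (G ⊕ B) D →
  ∑ℕ n (extend (deficit p G D)) ≤ edgeCount B
∑deficit≤edgeCount {n} p G B D pd = begin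
    ∑ℕ n (extend (deficit p G D))
  ≡⟨ sym (∑≡∑ℕ-extend n _) ⟩
    ∑[ v < n ] deficit p G D v
  ≤⟨ ∑-mono n paid ⟩
    ∑[ i < n ] (bit (not (lookup D i)) * ∑[ j < n ] bit (lookup D j ∧ adj B i j))
  ≤⟨ cut≤edgeCount B D ⟩
    edgeCount B
  ∎ where
  open ≤-Reasoning
  ∧∨-split : ∀ d a b → bit (d ∧ (a ∨ b)) ≤ bit (d ∧ a) + bit (d ∧ b)
  ∧∨-split false a b = z≤n
  ∧∨-split true true b = s≤s z≤n
  ∧∨-split true false true = s≤s z≤n
  ∧∨-split true false false = z≤n
  split-nbhd : ∀ v → ∣ D ∩ N (G ⊕ B) v ∣ ≤ ∑[ j < n ] bit (lookup D j ∧ adj G v j) + ∑[ j < n ] bit (lookup D j ∧ adj B v j)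
  split-nbhd v = ≤-trans (≤-reflexive (∣∩∣≡∑ D (λ j → adj G v j ∨ adj B v j)))
                   (≤-trans (∑-mono n (λ j → ∧∨-split (lookup D j) (adj G v j) (adj B v j))) (≤-reflexive (∑-distrib-+ {n} _ _)))
  paid : ∀ v → deficit p G D v ≤ bit (not (lookup D v)) * ∑[ j < n ] bit (lookup D j ∧ adj B v j)
  paid v with lookup D v in eD
  ... | true = z≤n
  ... | false = +-monoˡ-≤ 0 (m≤n+o⇒m∸n≤o p _ (≤-trans (pd v (lookup⇒∉ D v eD)) (split-nbhd v)))

NbhdWithin : ∀ {n} → Graph n → Fin n → (ℕ → ℕ) → Set
NbhdWithin G w I = ∀ j → adj G w j ≡ true → 1 ≤ I (toℕ j)

NbhdContains : ∀ {n} → Graph n → Fin n → (ℕ → ℕ) → Set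
NbhdContains G w I = ∀ j → 1 ≤ I (toℕ j) → adj G w j ≡ true

∑χ-rewrite : ∀ {n} (D : Subset n) (I : ℕ → ℕ) →
  ∑[ j < n ] (bit (lookup D j) * I (toℕ j)) ≡ ∑ℕ n (λ v → χ D v * I v)
∑χ-rewrite {n} D I = trans (∑-cong n (λ j → cong (_* I (toℕ j)) (sym (χ-toℕ D j)))) (∑-toℕ n (λ v → χ D v * I v))

∣D∩N∣≤ : ∀ {n} (G : Graph n) (D : Subset n) w (I : ℕ → ℕ) → NbhdWithin G w I →
  ∑[ j < n ] bit (lookup D j ∧ adj G w j) ≤ ∑ℕ n (λ v → χ D v * I v)
∣D∩N∣≤ {n} G D w I within = ≤-trans (∑-mono n term) (≤-reflexive (∑χ-rewrite D I))
  where
  term : ∀ j → bit (lookup D j ∧ adj G w j) ≤ bit (lookup D j) * I (toℕ j)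
  term j with lookup D j | adj G w j in e
  ... | false | _ = z≤n
  ... | true | false = z≤n
  ... | true | true = ≤-trans (within j e) (≤-reflexive (sym (+-identityʳ _)))

≤∣D∩N∣ : ∀ {n} (G : Graph n) (D : Subset n) w (I : ℕ → ℕ) → (∀ v → I v ≤ 1) → NbhdContains G w I →
  ∑ℕ n (λ v → χ D v * I v) ≤ ∣ D ∩ N G w ∣
≤∣D∩N∣ {n} G D w I I≤1 contains =
  ≤-trans (≤-reflexive (sym (∑χ-rewrite D I))) (≤-trans (∑-mono n term) (≤-reflexive (sym (∣∩∣≡∑ D (adj G w)))))
  where
  term : ∀ j → bit (lookup D j) * I (toℕ j) ≤ bit (lookup D j ∧ adj G w j)
  term j with I (toℕ j) in eI | I≤1 (toℕ j)
  ... | zero | _ = ≤-trans (≤-reflexive (*-zeroʳ (bit (lookup D j)))) z≤n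
  ... | suc zero | _ rewrite contains j (≤-reflexive (sym eI)) with lookup D j
  ...   | true = s≤s z≤n
  ...   | false = z≤n
  term j | suc (suc _) | s≤s ()

deficit≥ : ∀ {n} p (G : Graph n) D v (I : ℕ → ℕ) → v < n → (∀ w → toℕ w ≡ v → NbhdWithin G w I) →
  (1 ∸ χ D v) * (p ∸ ∑ℕ n (λ u → χ D u * I u)) ≤ extend (deficit p G D) v
deficit≥ {n} p G D v I v<n within with fromℕ< v<n | toℕ-fromℕ< v<n
... | w | refl = begin
    (1 ∸ χ D (toℕ w)) * (p ∸ ∑ℕ n (λ u → χ D u * I u))
  ≡⟨ cong (λ x → (1 ∸ x) * (p ∸ ∑ℕ n (λ u → χ D u * I u))) (χ-toℕ D w) ⟩
    (1 ∸ bit (lookup D w)) * (p ∸ ∑ℕ n (λ u → χ D u * I u))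
  ≡⟨ cong (_* (p ∸ ∑ℕ n (λ u → χ D u * I u))) (1∸bit (lookup D w)) ⟩
    bit (not (lookup D w)) * (p ∸ ∑ℕ n (λ u → χ D u * I u))
  ≤⟨ *-monoʳ-≤ (bit (not (lookup D w))) (∸-monoʳ-≤ p (∣D∩N∣≤ G D w I (within w refl))) ⟩
    deficit p G D w
  ≡⟨ sym (extend-toℕ (deficit p G D) w) ⟩
    extend (deficit p G D) (toℕ w)
  ∎ where
  open ≤-Reasoning
  1∸bit : ∀ b → 1 ∸ bit b ≡ bit (not b)
  1∸bit true = refl
  1∸bit false = refl

dominated-via : ∀ {n} p (G : Graph n) (D : Subset n) w (I : ℕ → ℕ) → (∀ u → I u ≤ 1) →
  NbhdContains G w I → p ≤ ∑ℕ n (λ u → χ D u * I u) → p ≤ ∣ D ∩ N G w ∣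
dominated-via p G D w I I≤1 contains le = ≤-trans le (≤∣D∩N∣ G D w I I≤1 contains)

rp-from-bounds : ∀ {n} p (G : Graph n) γ r → p < γ → 0 < r →
  (Σ (Subset n) λ D → IsPDom p G D × ∣ D ∣ ≡ γ) →
  (∀ B D → IsPDom p (G ⊕ B) D → ∣ D ∣ < γ → r ≤ edgeCount B) →
  (B₀ : Graph n) → Disjoint B₀ G → edgeCount B₀ ≤ r →
  (Σ (Subset n) λ D → IsPDom p (G ⊕ B₀) D × ∣ D ∣ < γ) →
  IsRP p G r
rp-from-bounds {n} p G γ r p<γ 0<r (D₀ , D₀-dom , ∣D₀∣) lower B₀ B₀∩G=∅ ∣B₀∣≤r (D₁ , D₁-dom , ∣D₁∣<γ) =
  small , large
  where
  γ-is : ∀ k → IsGammaP p G k → k ≡ γ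
  γ-is k ((D , D-dom , ∣D∣) , minimal) = ≤-antisym (≤-trans (minimal D₀ D₀-dom) (≤-reflexive ∣D₀∣)) γ≤k
    where
    γ≤k : γ ≤ k
    γ≤k with γ ≤? k
    ... | yes le = le
    ... | no nle = ⊥-elim (<⇒≱ 0<r (≤-trans (lower emptyGraph D (isPDom-⊕empty p G D D-dom) (subst (_< γ) (sym ∣D∣) (≰⇒> nle)))
                                             (≤-reflexive (edgeCount-empty {n}))))
  small : ∀ k → IsGammaP p G k → k ≤ p → r ≡ 0
  small k γk k≤p = ⊥-elim (≤⇒≯ k≤p (subst (p <_) (sym (γ-is k γk)) p<γ))
  r≤ : ∀ B → Reinforcing p G B → r ≤ edgeCount B
  r≤ B (_ , k , k' , γk , ((D , D-dom , ∣D∣) , _) , k'<k) =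
    lower B D D-dom (subst₂ _<_ (sym ∣D∣) (γ-is k γk) k'<k)
  large : ∀ k → IsGammaP p G k → p < k →
    (Σ (Graph n) λ B → Reinforcing p G B × edgeCount B ≡ r) × (∀ B → Reinforcing p G B → r ≤ edgeCount B)
  large k γk _ with γ-exists p (G ⊕ B₀)
  ... | k' , γk' = (B₀ , (B₀∩G=∅ , k , k' , γk , γk' , k'<k) , ≤-antisym ∣B₀∣≤r (lower B₀ D₁ D₁-dom ∣D₁∣<γ)) , r≤
    where
    k'<k : k' < k
    k'<k = subst (k' <_) (sym (γ-is k γk)) (≤-<-trans (proj₂ γk' D₁ D₁-dom) ∣D₁∣<γ)

degree≤ : ∀ {n} (H : Graph n) w (I : ℕ → ℕ) → NbhdWithin H w I → ∑[ j < n ] bit (adj H w j) ≤ ∑ℕ n I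
degree≤ {n} H w I within = ≤-trans (∑-mono n term) (≤-reflexive (∑-toℕ n I))
  where
  term : ∀ j → bit (adj H w j) ≤ I (toℕ j)
  term j with adj H w j in e
  ... | true = within j e
  ... | false = z≤n

Touches : ∀ {n} → ℕ → ℕ → Fin n → Set
Touches a b i = toℕ i ≡ a ⊎ toℕ i ≡ b

edgeCount≤two-stars : ∀ {n} (B : Graph n) a b (Ia Ib : ℕ → ℕ) → a < n → b < n →
  (∀ i j → adj B i j ≡ true → Touches a b i ⊎ Touches a b j) →
  (∀ w → toℕ w ≡ a → NbhdWithin B w Ia) → (∀ w → toℕ w ≡ b → NbhdWithin B w Ib) →
  edgeCount B ≤ ∑ℕ n Ia + ∑ℕ n Ib
edgeCount≤two-stars {n} B a b Ia Ib a<n b<n touches within-a within-b = begin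
    edgeCount B
  ≤⟨ edgeCount≤cover B C covered ⟩
    ∑[ i < n ] ∑[ j < n ] bit (C i ∧ adj B i j)
  ≤⟨ ∑-mono n row ⟩
    ∑[ i < n ] H (toℕ i)
  ≡⟨ ∑-toℕ n H ⟩
    ∑ℕ n H
  ≡⟨ ∑ℕ-+ n _ _ ⟩
    ∑ℕ n (λ u → da * ind a 1 u) + ∑ℕ n (λ u → db * ind b 1 u)
  ≡⟨ cong₂ _+_ (∑ℕ-point n a (λ _ → da) a<n) (∑ℕ-point n b (λ _ → db) b<n) ⟩
    da + db
  ∎ where
  open ≤-Reasoning
  da db : ℕ
  da = ∑ℕ n Ia
  db = ∑ℕ n Ib
  C : Fin n → Bool
  C i = (toℕ i ≡ᵇ a) ∨ (toℕ i ≡ᵇ b)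
  C-intro : ∀ i → Touches a b i → C i ≡ true
  C-intro i (inj₁ e) = ∨-introˡ _ (≡ᵇ-intro _ _ e)
  C-intro i (inj₂ e) = ∨-introʳ (toℕ i ≡ᵇ a) (≡ᵇ-intro _ _ e)
  covered : ∀ i j → adj B i j ≡ true → C i ∨ C j ≡ true
  covered i j h with touches i j h
  ... | inj₁ t = ∨-introˡ (C j) (C-intro i t)
  ... | inj₂ t = ∨-introʳ (C i) (C-intro j t)
  H : ℕ → ℕ
  H u = da * ind a 1 u + db * ind b 1 u
  H-at-a : da ≤ H a
  H-at-a = ≤-trans (≤-reflexive (sym (trans (cong (da *_) (ind-at a)) (*-identityʳ da)))) (m≤m+n _ _)
  H-at-b : db ≤ H b
  H-at-b = ≤-trans (≤-reflexive (sym (trans (cong (db *_) (ind-at b)) (*-identityʳ db)))) (m≤n+m _ _)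
  row : ∀ i → ∑[ j < n ] bit (C i ∧ adj B i j) ≤ H (toℕ i)
  row i with C i in eC
  ... | false = ≤-trans (≤-reflexive (∑-zero n _ (λ _ → refl))) z≤n
  ... | true with ∨-true (toℕ i ≡ᵇ a) (toℕ i ≡ᵇ b) eC
  ...   | inj₁ ea = ≤-trans (degree≤ B i Ia (within-a i (≡ᵇ-true _ _ ea)))
                      (subst (λ u → da ≤ H u) (sym (≡ᵇ-true _ _ ea)) H-at-a)
  ...   | inj₂ eb = ≤-trans (degree≤ B i Ib (within-b i (≡ᵇ-true _ _ eb)))
                      (subst (λ u → db ≤ H u) (sym (≡ᵇ-true _ _ eb)) H-at-b)

InBlock : ℕ → ℕ → ℕ → Set
InBlock a M v = a ≤ v × v < a + M

in-block : ∀ {a M v} → InBlock a M v → 1 ≤ ind a M v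
in-block {a} {M} {v} (lo , hi) = ≤-reflexive (sym (ind-in a M v lo hi))

in-blocks : ∀ {a M b M' v} → InBlock a M v ⊎ InBlock b M' v → 1 ≤ ind a M v + ind b M' v
in-blocks {b = b} {M'} {v} (inj₁ x) = ≤-trans (in-block x) (m≤m+n _ (ind b M' v))
in-blocks {a} {M} {v = v} (inj₂ y) = ≤-trans (in-block y) (m≤n+m _ (ind a M v))

InBlock-point : ∀ {a v} → InBlock a 1 v → v ≡ a
InBlock-point {a} (lo , hi) = ≤-antisym (s≤s⁻¹ (≤-trans hi (≤-reflexive (+-comm a 1)))) lo

block-dominates : ∀ {n} (H : Graph n) D w a M → a + M ≤ n →
  (∀ j → InBlock a M (toℕ j) → adj H w j ≡ true) → (∀ k → k < M → χ D (a + k) ≡ 1) →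
  M ≤ ∣ D ∩ N H w ∣
block-dominates {n} H D w a M a+M≤n adjacent inD =
  dominated-via M H D w (ind a M) (ind≤1 a M) (λ j h → adjacent j (ind-pos a M (toℕ j) h))
    (≤-reflexive (sym (trans (∑ℕ-range n a M (χ D) a+M≤n) (∑ℕ-ones M _ inD))))

two-blocks-dominate : ∀ {n} (H : Graph n) D w a M b M' → a + M ≤ b → b + M' ≤ n →
  (∀ j → InBlock a M (toℕ j) ⊎ InBlock b M' (toℕ j) → adj H w j ≡ true) →
  (∀ k → k < M → χ D (a + k) ≡ 1) → (∀ k → k < M' → χ D (b + k) ≡ 1) →
  M + M' ≤ ∣ D ∩ N H w ∣
two-blocks-dominate {n} H D w a M b M' a+M≤b b+M'≤n adjacent inD inD' =
  dominated-via (M + M') H D w I (λ v → ind-disjoint a M b M' v a+M≤b) contains (≤-reflexive (sym count))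
  where
  I : ℕ → ℕ
  I v = ind a M v + ind b M' v
  contains : NbhdContains H w I
  contains j h with 1≤+-split (ind a M (toℕ j)) _ h
  ... | inj₁ h₁ = adjacent j (inj₁ (ind-pos a M (toℕ j) h₁))
  ... | inj₂ h₂ = adjacent j (inj₂ (ind-pos b M' (toℕ j) h₂))
  count : ∑ℕ n (λ v → χ D v * I v) ≡ M + M'
  count = trans (∑ℕ-*-+ n (χ D) (ind a M) (ind b M'))
                (cong₂ _+_ (trans (∑ℕ-range n a M (χ D) (≤-trans (m≤m+n (a + M) M') (≤-trans (+-monoˡ-≤ M' a+M≤b) b+M'≤n)))
                                  (∑ℕ-ones M _ inD))
                           (trans (∑ℕ-range n b M' (χ D) b+M'≤n) (∑ℕ-ones M' _ inD')))

fromEdges-adj : ∀ n e (i j : Fin n) → adj (fromEdges n e) i j ≡ true →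
  e (toℕ i) (toℕ j) ≡ true ⊎ e (toℕ j) (toℕ i) ≡ true
fromEdges-adj n e i j h = ∨-true _ _ (proj₂ (∧-true (not (toℕ i ≡ᵇ toℕ j)) _ h))

fromEdges-intro : ∀ n e (i j : Fin n) → toℕ i ≢ toℕ j →
  (e (toℕ i) (toℕ j) ≡ true ⊎ e (toℕ j) (toℕ i) ≡ true) → adj (fromEdges n e) i j ≡ true
fromEdges-intro n e i j ne edge = ∧-intro (cong not (¬-not (λ t → ne (≡ᵇ-true _ _ t)))) (either edge)
  where
  either : (e (toℕ i) (toℕ j) ≡ true ⊎ e (toℕ j) (toℕ i) ≡ true) → (e (toℕ i) (toℕ j) ∨ e (toℕ j) (toℕ i)) ≡ true
  either (inj₁ x) = ∨-introˡ _ x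
  either (inj₂ y) = ∨-introʳ _ y

-- A vertex y with weight c ∈ {0,1} (y ∈ D?),
-- adjacent to a vertex of weight c₀ and to M leaves, L of them in D and l = M - L
-- outside, has (with p = M + 1) total deficit over y and its leaves
--   (1 - c)(p - c₀ - L) + l (p - c) = l M + (1 - c)(2l + 1 - c₀).
starDeficit : ℕ → ℕ → ℕ → ℕ → ℕ → ℕ
starDeficit M c₀ c l L = (1 ∸ c) * (suc M ∸ (c₀ + L)) + l * (suc M ∸ c)

starDeficit≡ : ∀ M c₀ c l L → c₀ ≤ 1 → c ≤ 1 → l + L ≡ M →
  starDeficit M c₀ c l L ≡ l * M + (1 ∸ c) * (l + l + (1 ∸ c₀))
starDeficit≡ M c₀ c l L _ (s≤s z≤n) _ = sym (+-identityʳ _)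
starDeficit≡ .(l + L) .0 .0 l L z≤n z≤n refl
  rewrite +-∸-assoc 1 {l + L} {L} (m≤n+m L l) | m+n∸n≡m l L = lemma l L
  where
  lemma : ∀ l L → suc l + 0 + l * suc (l + L) ≡ l * (l + L) + ((l + l + 1) + 0)
  lemma = solve-∀
starDeficit≡ .(l + L) .1 .0 l L (s≤s z≤n) z≤n refl
  rewrite m+n∸n≡m l L = lemma l L
  where
  lemma : ∀ l L → l + 0 + l * suc (l + L) ≡ l * (l + L) + ((l + l + 0) + 0)
  lemma = solve-∀

-- The total deficit of F_{p-1} in terms of the membership bits c₀, c₁, c₂ of
-- x, x₁, x₂ and the numbers l₁, l₂ of leaves of x₁, x₂ outside D (p = q + 3).
F-total : ℕ → ℕ → ℕ → ℕ → ℕ → ℕ → ℕ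
F-total q c₀ c₁ c₂ l₁ l₂ = (1 ∸ c₀) * (3 + q ∸ (c₁ + c₂))
  + (l₁ * (2 + q) + (1 ∸ c₁) * (l₁ + l₁ + (1 ∸ c₀)))
  + (l₂ * (2 + q) + (1 ∸ c₂) * (l₂ + l₂ + (1 ∸ c₀)))

-- two leaves outside D already have deficit ≥ 2(p - 1) ≥ p + 1
F-two-missing-leaves : ∀ q c₀ c₁ c₂ l₁ l₂ → 2 ≤ l₁ + l₂ → 4 + q ≤ F-total q c₀ c₁ c₂ l₁ l₂
F-two-missing-leaves q c₀ c₁ c₂ l₁ l₂ two = begin
    4 + q                 ≤⟨ ≤-by q (double q) ⟩
    2 * (2 + q)           ≤⟨ *-monoˡ-≤ (2 + q) two ⟩
    (l₁ + l₂) * (2 + q)   ≡⟨ *-distribʳ-+ (2 + q) l₁ l₂ ⟩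
    l₁ * (2 + q) + l₂ * (2 + q)
  ≤⟨ +-mono-≤ (m≤m+n (l₁ * (2 + q)) _) (m≤m+n (l₂ * (2 + q)) _) ⟩
    (l₁ * (2 + q) + (1 ∸ c₁) * (l₁ + l₁ + (1 ∸ c₀))) + (l₂ * (2 + q) + (1 ∸ c₂) * (l₂ + l₂ + (1 ∸ c₀)))
  ≤⟨ m≤n+m _ ((1 ∸ c₀) * (3 + q ∸ (c₁ + c₂))) ⟩
    (1 ∸ c₀) * (3 + q ∸ (c₁ + c₂)) + ((l₁ * (2 + q) + (1 ∸ c₁) * (l₁ + l₁ + (1 ∸ c₀)))
                                   + (l₂ * (2 + q) + (1 ∸ c₂) * (l₂ + l₂ + (1 ∸ c₀))))
  ≡⟨ sym (+-assoc ((1 ∸ c₀) * (3 + q ∸ (c₁ + c₂))) _ _) ⟩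
    F-total q c₀ c₁ c₂ l₁ l₂
  ∎ where
  open ≤-Reasoning
  double : ∀ q → 2 * (2 + q) ≡ 4 + q + q
  double = solve-∀

F-total-swap : ∀ q c₀ c₁ c₂ l₁ l₂ → F-total q c₀ c₂ c₁ l₂ l₁ ≡ F-total q c₀ c₁ c₂ l₁ l₂
F-total-swap q c₀ c₁ c₂ l₁ l₂ =
  trans (cong (λ s → (1 ∸ c₀) * (3 + q ∸ s) + star₂ + star₁) (+-comm c₂ c₁))
        (swap-last ((1 ∸ c₀) * (3 + q ∸ (c₁ + c₂))) star₂ star₁)
  where
  star₁ star₂ : ℕ
  star₁ = l₁ * (2 + q) + (1 ∸ c₁) * (l₁ + l₁ + (1 ∸ c₀))
  star₂ = l₂ * (2 + q) + (1 ∸ c₂) * (l₂ + l₂ + (1 ∸ c₀))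
  swap-last : ∀ x a b → x + a + b ≡ x + b + a
  swap-last = solve-∀

-- none of x, x₁, x₂ in D: x alone lacks p, and x₁, x₂ lack at least 1 each
F-none-in-D : ∀ q l₁ l₂ → 4 + q ≤ F-total q 0 0 0 l₁ l₂
F-none-in-D q l₁ l₂ = ≤-by (l₁ * (2 + q) + l₁ + l₁ + l₂ * (2 + q) + l₂ + l₂ + 1) (lemma l₁ l₂ q)
  where
  lemma : ∀ l₁ l₂ q → 1 * (3 + q) + (l₁ * (2 + q) + 1 * (l₁ + l₁ + 1)) + (l₂ * (2 + q) + 1 * (l₂ + l₂ + 1))
                      ≡ 4 + q + (l₁ * (2 + q) + l₁ + l₁ + l₂ * (2 + q) + l₂ + l₂ + 1)
  lemma = solve-∀

-- only x in D: some leaf is missing, lacking p - 1, and its centre lacks 2 more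
F-only-x : ∀ q l₁ l₂ → 1 ≤ l₁ + l₂ → 4 + q ≤ F-total q 1 0 0 l₁ l₂
F-only-x q l₁ l₂ one = begin
    4 + q               ≡⟨ sym (*-identityˡ (4 + q)) ⟩
    1 * (4 + q)         ≤⟨ *-monoˡ-≤ (4 + q) one ⟩
    (l₁ + l₂) * (4 + q) ≡⟨ lemma l₁ l₂ q ⟩
    F-total q 1 0 0 l₁ l₂
  ∎ where
  open ≤-Reasoning
  lemma : ∀ l₁ l₂ q → (l₁ + l₂) * (4 + q) ≡ 0 + (l₁ * (2 + q) + 1 * (l₁ + l₁ + 0)) + (l₂ * (2 + q) + 1 * (l₂ + l₂ + 0))
  lemma = solve-∀

-- only x₁ in D: x lacks p - 1, some leaf lacks ≥ p - 1 and x₂ lacks ≥ 1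
F-only-x₁ : ∀ q l₁ l₂ → 1 ≤ l₁ + l₂ → 4 + q ≤ F-total q 0 1 0 l₁ l₂
F-only-x₁ q l₁ l₂ one = begin
    4 + q                                         ≤⟨ ≤-by q (twice q) ⟩
    (2 + q) + 1 * (2 + q)                         ≤⟨ +-monoʳ-≤ (2 + q) (*-monoˡ-≤ (2 + q) one) ⟩
    (2 + q) + (l₁ + l₂) * (2 + q)                 ≤⟨ m≤m+n _ (l₂ + l₂ + 1) ⟩
    (2 + q) + (l₁ + l₂) * (2 + q) + (l₂ + l₂ + 1) ≡⟨ lemma l₁ l₂ q ⟩
    F-total q 0 1 0 l₁ l₂
  ∎ where
  open ≤-Reasoning
  twice : ∀ q → (2 + q) + 1 * (2 + q) ≡ 4 + q + q
  twice = solve-∀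
  lemma : ∀ l₁ l₂ q → (2 + q) + (l₁ + l₂) * (2 + q) + (l₂ + l₂ + 1)
                      ≡ 1 * (2 + q) + (l₁ * (2 + q) + 0) + (l₂ * (2 + q) + 1 * (l₂ + l₂ + 1))
  lemma = solve-∀

-- Arithmetic core for F_{p-1}: if c₀ + c₁ + c₂ ≤ l₁ + l₂ (which is what
-- |D| ≤ 2p - 2 amounts to), the deficits of x and of both stars total at least
-- p + 1.  When two of the cᵢ are 1, two leaves are missing.
F-arith : ∀ q c₀ c₁ c₂ l₁ l₂ → c₀ ≤ 1 → c₁ ≤ 1 → c₂ ≤ 1 → c₀ + c₁ + c₂ ≤ l₁ + l₂ →
  4 + q ≤ F-total q c₀ c₁ c₂ l₁ l₂
F-arith q _ _ _ l₁ l₂ z≤n z≤n z≤n _ = F-none-in-D q l₁ l₂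
F-arith q _ _ _ l₁ l₂ (s≤s z≤n) z≤n z≤n one = F-only-x q l₁ l₂ one
F-arith q _ _ _ l₁ l₂ z≤n (s≤s z≤n) z≤n one = F-only-x₁ q l₁ l₂ one
F-arith q _ _ _ l₁ l₂ z≤n z≤n (s≤s z≤n) one =
  subst (4 + q ≤_) (F-total-swap q 0 0 1 l₁ l₂) (F-only-x₁ q l₂ l₁ (subst (1 ≤_) (+-comm l₁ l₂) one))
F-arith q _ _ _ l₁ l₂ (s≤s z≤n) (s≤s z≤n) z≤n two = F-two-missing-leaves q 1 1 0 l₁ l₂ two
F-arith q _ _ _ l₁ l₂ (s≤s z≤n) z≤n (s≤s z≤n) two = F-two-missing-leaves q 1 0 1 l₁ l₂ two
F-arith q _ _ _ l₁ l₂ z≤n (s≤s z≤n) (s≤s z≤n) two = F-two-missing-leaves q 0 1 1 l₁ l₂ two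
F-arith q _ _ _ l₁ l₂ (s≤s z≤n) (s≤s z≤n) (s≤s z≤n) three = F-two-missing-leaves q 1 1 1 l₁ l₂ (≤-trans (n≤1+n 2) three)

-- The tree F_{p-1}, p = q + 3, m = p - 1 leaves per star.  Vertices (Defs.F):
-- x = 0, x₁ = 1, x₂ = 2, the leaves of x₁ are 3 + k and those of x₂ are
-- 3 + m + k (k < m).
module F-tree (q : ℕ) where
  m p n : ℕ
  m = 2 + q
  p = 1 + m
  n = suc (p + p)

  G : Graph n
  G = F p

  x-edgeᵇ x₁-edgeᵇ x₂-edgeᵇ F-edgeᵇ : ℕ → ℕ → Bool
  x-edgeᵇ a b = (a ≡ᵇ 0) ∧ ((b ≡ᵇ 1) ∨ (b ≡ᵇ 2))
  x₁-edgeᵇ a b = (a ≡ᵇ 1) ∧ inRange 3 (p + 1) b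
  x₂-edgeᵇ a b = (a ≡ᵇ 2) ∧ inRange (p + 2) (p + p) b
  F-edgeᵇ a b = x-edgeᵇ a b ∨ x₁-edgeᵇ a b ∨ x₂-edgeᵇ a b

  F-edge : ℕ → ℕ → Set
  F-edge a b = (a ≡ 0 × (b ≡ 1 ⊎ b ≡ 2)) ⊎ (a ≡ 1 × 3 ≤ b × b ≤ p + 1) ⊎ (a ≡ 2 × p + 2 ≤ b × b ≤ p + p)

  F-edge-sound : ∀ a b → F-edgeᵇ a b ≡ true → F-edge a b
  F-edge-sound a b h with ∨-true _ _ h
  ... | inj₁ h₀ with ∧-true _ _ h₀
  ...   | x , y with ∨-true _ _ y
  ...     | inj₁ z = inj₁ (≡ᵇ-true a 0 x , inj₁ (≡ᵇ-true b 1 z))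
  ...     | inj₂ z = inj₁ (≡ᵇ-true a 0 x , inj₂ (≡ᵇ-true b 2 z))
  F-edge-sound a b h | inj₂ h' with ∨-true _ _ h'
  ... | inj₁ h₁ with ∧-true _ _ h₁
  ...   | x , y = inj₂ (inj₁ (≡ᵇ-true a 1 x , inRange-true 3 (p + 1) b y))
  F-edge-sound a b h | inj₂ h' | inj₂ h₂ with ∧-true _ _ h₂
  ...   | x , y = inj₂ (inj₂ (≡ᵇ-true a 2 x , inRange-true (p + 2) (p + p) b y))

  F-edge-complete : ∀ a b → F-edge a b → F-edgeᵇ a b ≡ true
  F-edge-complete a b (inj₁ (x , inj₁ y)) =
    ∨-introˡ _ (∧-intro (≡ᵇ-intro a 0 x) (∨-introˡ _ (≡ᵇ-intro b 1 y)))
  F-edge-complete a b (inj₁ (x , inj₂ y)) =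
    ∨-introˡ _ (∧-intro (≡ᵇ-intro a 0 x) (∨-introʳ _ (≡ᵇ-intro b 2 y)))
  F-edge-complete a b (inj₂ (inj₁ (x , y , z))) =
    ∨-introʳ (x-edgeᵇ a b) (∨-introˡ _ (∧-intro (≡ᵇ-intro a 1 x) (inRange-intro 3 (p + 1) b y z)))
  F-edge-complete a b (inj₂ (inj₂ (x , y , z))) =
    ∨-introʳ (x-edgeᵇ a b) (∨-introʳ (x₁-edgeᵇ a b) (∧-intro (≡ᵇ-intro a 2 x) (inRange-intro (p + 2) (p + p) b y z)))

  F-adj : ∀ i j → adj G i j ≡ true → F-edge (toℕ i) (toℕ j) ⊎ F-edge (toℕ j) (toℕ i)
  F-adj i j h with fromEdges-adj n F-edgeᵇ i j h
  ... | inj₁ e = inj₁ (F-edge-sound (toℕ i) (toℕ j) e)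
  ... | inj₂ e = inj₂ (F-edge-sound (toℕ j) (toℕ i) e)

  F-adj-intro : ∀ i j → toℕ i ≢ toℕ j → F-edge (toℕ i) (toℕ j) ⊎ F-edge (toℕ j) (toℕ i) → adj G i j ≡ true
  F-adj-intro i j ne (inj₁ e) = fromEdges-intro n F-edgeᵇ i j ne (inj₁ (F-edge-complete _ _ e))
  F-adj-intro i j ne (inj₂ e) = fromEdges-intro n F-edgeᵇ i j ne (inj₂ (F-edge-complete _ _ e))

  F-nbhd-at : ∀ {a} w j → toℕ w ≡ a → adj G w j ≡ true → F-edge a (toℕ j) ⊎ F-edge (toℕ j) a
  F-nbhd-at w j refl h = F-adj w j h

  nb-x : ∀ b → F-edge 0 b ⊎ F-edge b 0 → b ≡ 1 ⊎ b ≡ 2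
  nb-x b (inj₁ (inj₁ (_ , e))) = e
  nb-x b (inj₁ (inj₂ (inj₁ (() , _))))
  nb-x b (inj₁ (inj₂ (inj₂ (() , _))))
  nb-x b (inj₂ (inj₁ (_ , inj₁ ())))
  nb-x b (inj₂ (inj₁ (_ , inj₂ ())))
  nb-x b (inj₂ (inj₂ (inj₁ (_ , () , _))))
  nb-x b (inj₂ (inj₂ (inj₂ (_ , () , _))))

  nb-x₁ : ∀ b → F-edge 1 b ⊎ F-edge b 1 → b ≡ 0 ⊎ (3 ≤ b × b ≤ p + 1)
  nb-x₁ b (inj₁ (inj₁ (() , _)))
  nb-x₁ b (inj₁ (inj₂ (inj₁ (_ , range)))) = inj₂ range
  nb-x₁ b (inj₁ (inj₂ (inj₂ (() , _))))
  nb-x₁ b (inj₂ (inj₁ (e , _))) = inj₁ e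
  nb-x₁ b (inj₂ (inj₂ (inj₁ (_ , s≤s () , _))))
  nb-x₁ b (inj₂ (inj₂ (inj₂ (_ , s≤s () , _))))

  nb-x₂ : ∀ b → F-edge 2 b ⊎ F-edge b 2 → b ≡ 0 ⊎ (p + 2 ≤ b × b ≤ p + p)
  nb-x₂ b (inj₁ (inj₁ (() , _)))
  nb-x₂ b (inj₁ (inj₂ (inj₁ (() , _))))
  nb-x₂ b (inj₁ (inj₂ (inj₂ (_ , range)))) = inj₂ range
  nb-x₂ b (inj₂ (inj₁ (e , _))) = inj₁ e
  nb-x₂ b (inj₂ (inj₂ (inj₁ (_ , s≤s (s≤s ()) , _))))
  nb-x₂ b (inj₂ (inj₂ (inj₂ (_ , s≤s (s≤s ()) , _))))

  nb-leaf₁ : ∀ a b → 3 ≤ a → a ≤ p + 1 → F-edge a b ⊎ F-edge b a → b ≡ 1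
  nb-leaf₁ _ b (s≤s (s≤s (s≤s _))) _ (inj₁ (inj₁ (() , _)))
  nb-leaf₁ _ b (s≤s (s≤s (s≤s _))) _ (inj₁ (inj₂ (inj₁ (() , _))))
  nb-leaf₁ _ b (s≤s (s≤s (s≤s _))) _ (inj₁ (inj₂ (inj₂ (() , _))))
  nb-leaf₁ _ b (s≤s (s≤s (s≤s _))) _ (inj₂ (inj₁ (_ , inj₁ ())))
  nb-leaf₁ _ b (s≤s (s≤s (s≤s _))) _ (inj₂ (inj₁ (_ , inj₂ ())))
  nb-leaf₁ a b _ _ (inj₂ (inj₂ (inj₁ (e , _)))) = e
  nb-leaf₁ a b _ a≤p+1 (inj₂ (inj₂ (inj₂ (_ , p+2≤a , _)))) =
    ⊥-elim (≤⇒≯ a≤p+1 (≤-trans (≤-reflexive (sym (+-suc p 1))) p+2≤a))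

  nb-leaf₂ : ∀ a b → p + 2 ≤ a → a ≤ p + p → F-edge a b ⊎ F-edge b a → b ≡ 2
  nb-leaf₂ _ b (s≤s (s≤s (s≤s _))) _ (inj₁ (inj₁ (() , _)))
  nb-leaf₂ _ b (s≤s (s≤s (s≤s _))) _ (inj₁ (inj₂ (inj₁ (() , _))))
  nb-leaf₂ _ b (s≤s (s≤s (s≤s _))) _ (inj₁ (inj₂ (inj₂ (() , _))))
  nb-leaf₂ _ b (s≤s (s≤s (s≤s _))) _ (inj₂ (inj₁ (_ , inj₁ ())))
  nb-leaf₂ _ b (s≤s (s≤s (s≤s _))) _ (inj₂ (inj₁ (_ , inj₂ ())))
  nb-leaf₂ a b p+2≤a _ (inj₂ (inj₂ (inj₁ (_ , _ , a≤p+1)))) =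
    ⊥-elim (≤⇒≯ a≤p+1 (≤-trans (≤-reflexive (sym (+-suc p 1))) p+2≤a))
  nb-leaf₂ a b _ _ (inj₂ (inj₂ (inj₂ (e , _)))) = e

  n≡3+m+m : n ≡ 3 + m + m
  n≡3+m+m = cong (λ x → suc (suc x)) (+-suc m m)

  ∑ℕ-F : ∀ (f : ℕ → ℕ) → ∑ℕ n f ≡ f 0 + (f 1 + ∑ℕ m (λ k → f (3 + k))) + (f 2 + ∑ℕ m (λ k → f (3 + m + k)))
  ∑ℕ-F f = begin
      ∑ℕ n f
    ≡⟨ cong (λ x → ∑ℕ x f) n≡3+m+m ⟩
      ∑ℕ (3 + (m + m)) f
    ≡⟨ ∑ℕ-split 3 (m + m) f ⟩
      f 0 + (f 1 + (f 2 + 0)) + ∑ℕ (m + m) (λ k → f (3 + k))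
    ≡⟨ cong (f 0 + (f 1 + (f 2 + 0)) +_) (∑ℕ-split m m (λ k → f (3 + k))) ⟩
      f 0 + (f 1 + (f 2 + 0)) + (∑ℕ m (λ k → f (3 + k)) + ∑ℕ m (λ k → f (3 + m + k)))
    ≡⟨ regroup (f 0) (f 1) (f 2) _ _ ⟩
      f 0 + (f 1 + ∑ℕ m (λ k → f (3 + k))) + (f 2 + ∑ℕ m (λ k → f (3 + m + k)))
    ∎ where
    open ≡-Reasoning
    regroup : ∀ a b c d e → a + (b + (c + 0)) + (d + e) ≡ a + (b + d) + (c + e)
    regroup = solve-∀

  3+m+m≤n : 3 + m + m ≤ n
  3+m+m≤n = ≤-reflexive (sym n≡3+m+m)

  3+m≤n : 3 + m ≤ n
  3+m≤n = ≤-trans (m≤m+n (3 + m) m) 3+m+m≤n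

  4+m≤n : 4 + m ≤ n
  4+m≤n = ≤-trans (≤-reflexive (+-comm 1 (3 + m))) (≤-trans (+-monoʳ-≤ (3 + m) (s≤s z≤n)) 3+m+m≤n)

  leaf₁<n : ∀ {k} → k < m → 3 + k < n
  leaf₁<n k<m = ≤-trans (s≤s (s≤s (s≤s k<m))) 3+m≤n

  leaf₂<n : ∀ {k} → k < m → 3 + m + k < n
  leaf₂<n k<m = ≤-trans (s≤s (s≤s (s≤s (+-monoʳ-< m k<m)))) 3+m+m≤n

  module Deficits (D : Subset n) where
    c f : ℕ → ℕ
    c = χ D
    f = extend (deficit p G D)

    L₁ L₂ l₁ l₂ : ℕ
    L₁ = ∑ℕ m (λ k → c (3 + k))
    L₂ = ∑ℕ m (λ k → c (3 + m + k))
    l₁ = ∑ℕ m (λ k → 1 ∸ c (3 + k))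
    l₂ = ∑ℕ m (λ k → 1 ∸ c (3 + m + k))

    deficit-x : (1 ∸ c 0) * (p ∸ (c 1 + c 2)) ≤ f 0
    deficit-x = subst (λ s → (1 ∸ c 0) * (p ∸ s) ≤ f 0)
      (trans (∑ℕ-*-+ n c (ind 1 1) (ind 2 1))
             (cong₂ _+_ (∑ℕ-point n 1 c (s≤s (s≤s z≤n))) (∑ℕ-point n 2 c (s≤s (s≤s (s≤s z≤n))))))
      (deficit≥ p G D 0 (λ u → ind 1 1 u + ind 2 1 u) (s≤s z≤n) within)
      where
      within : ∀ w → toℕ w ≡ 0 → NbhdWithin G w (λ u → ind 1 1 u + ind 2 1 u)
      within w ew j a with nb-x (toℕ j) (F-nbhd-at w j ew a)
      ... | inj₁ e rewrite e = s≤s z≤n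
      ... | inj₂ e rewrite e = s≤s z≤n

    deficit-x₁ : (1 ∸ c 1) * (p ∸ (c 0 + L₁)) ≤ f 1
    deficit-x₁ = subst (λ s → (1 ∸ c 1) * (p ∸ s) ≤ f 1)
      (trans (∑ℕ-*-+ n c (ind 0 1) (ind 3 m)) (cong₂ _+_ (∑ℕ-point n 0 c (s≤s z≤n)) (∑ℕ-range n 3 m c 3+m≤n)))
      (deficit≥ p G D 1 (λ u → ind 0 1 u + ind 3 m u) (s≤s (s≤s z≤n)) within)
      where
      within : ∀ w → toℕ w ≡ 1 → NbhdWithin G w (λ u → ind 0 1 u + ind 3 m u)
      within w ew j a with nb-x₁ (toℕ j) (F-nbhd-at w j ew a)
      ... | inj₁ e rewrite e = s≤s z≤n
      ... | inj₂ (lo , hi) = ≤-trans (≤-reflexive (sym (ind-in 3 m (toℕ j) lo (s≤s (≤-trans hi (≤-reflexive (+-comm p 1)))))))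
                                     (m≤n+m _ _)

    deficit-x₂ : (1 ∸ c 2) * (p ∸ (c 0 + L₂)) ≤ f 2
    deficit-x₂ = subst (λ s → (1 ∸ c 2) * (p ∸ s) ≤ f 2)
      (trans (∑ℕ-*-+ n c (ind 0 1) (ind (3 + m) m)) (cong₂ _+_ (∑ℕ-point n 0 c (s≤s z≤n)) (∑ℕ-range n (3 + m) m c 3+m+m≤n)))
      (deficit≥ p G D 2 (λ u → ind 0 1 u + ind (3 + m) m u) (s≤s (s≤s (s≤s z≤n))) within)
      where
      within : ∀ w → toℕ w ≡ 2 → NbhdWithin G w (λ u → ind 0 1 u + ind (3 + m) m u)
      within w ew j a with nb-x₂ (toℕ j) (F-nbhd-at w j ew a)
      ... | inj₁ e rewrite e = s≤s z≤n
      ... | inj₂ (lo , hi) =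
        ≤-trans (≤-reflexive (sym (ind-in (3 + m) m (toℕ j) (subst (_≤ toℕ j) (+-comm p 2) lo)
                                          (≤-trans (s≤s hi) (≤-reflexive n≡3+m+m)))))
                (m≤n+m _ _)

    deficit-leaves₁ : l₁ * (p ∸ c 1) ≤ ∑ℕ m (λ k → f (3 + k))
    deficit-leaves₁ = ≤-trans (≤-reflexive (sym (∑ℕ-*ʳ m (p ∸ c 1) (λ k → 1 ∸ c (3 + k))))) (∑ℕ-mono m leaf)
      where
      leaf : ∀ k → k < m → (1 ∸ c (3 + k)) * (p ∸ c 1) ≤ f (3 + k)
      leaf k k<m = subst (λ s → (1 ∸ c (3 + k)) * (p ∸ s) ≤ f (3 + k)) (∑ℕ-point n 1 c (s≤s (s≤s z≤n)))
        (deficit≥ p G D (3 + k) (ind 1 1) (leaf₁<n k<m) within)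
        where
        within : ∀ w → toℕ w ≡ 3 + k → NbhdWithin G w (ind 1 1)
        within w ew j a rewrite nb-leaf₁ (3 + k) (toℕ j) (s≤s (s≤s (s≤s z≤n)))
                                  (≤-trans (s≤s (s≤s k<m)) (≤-reflexive (+-comm 1 p))) (F-nbhd-at w j ew a) = s≤s z≤n

    deficit-leaves₂ : l₂ * (p ∸ c 2) ≤ ∑ℕ m (λ k → f (3 + m + k))
    deficit-leaves₂ = ≤-trans (≤-reflexive (sym (∑ℕ-*ʳ m (p ∸ c 2) (λ k → 1 ∸ c (3 + m + k))))) (∑ℕ-mono m leaf)
      where
      leaf : ∀ k → k < m → (1 ∸ c (3 + m + k)) * (p ∸ c 2) ≤ f (3 + m + k)
      leaf k k<m = subst (λ s → (1 ∸ c (3 + m + k)) * (p ∸ s) ≤ f (3 + m + k)) (∑ℕ-point n 2 c (s≤s (s≤s (s≤s z≤n))))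
        (deficit≥ p G D (3 + m + k) (ind 2 1) (leaf₂<n k<m) within)
        where
        within : ∀ w → toℕ w ≡ 3 + m + k → NbhdWithin G w (ind 2 1)
        within w ew j a rewrite nb-leaf₂ (3 + m + k) (toℕ j) (≤-trans (≤-reflexive (+-comm p 2)) (s≤s (s≤s (s≤s (m≤m+n m k)))))
                                  (s≤s⁻¹ (leaf₂<n k<m))
                                  (F-nbhd-at w j ew a) = s≤s z≤n

    few-in-D : ∣ D ∣ ≤ m + m → c 0 + c 1 + c 2 ≤ l₁ + l₂
    few-in-D size = +-cancelʳ-≤ (L₁ + L₂) _ _ (begin
        c 0 + c 1 + c 2 + (L₁ + L₂)       ≡⟨ regroup (c 0) (c 1) (c 2) L₁ L₂ ⟩
        c 0 + (c 1 + L₁) + (c 2 + L₂)     ≡⟨ sym (∑ℕ-F c) ⟩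
        ∑ℕ n c                            ≡⟨ sym (∣∣≡∑ℕχ D) ⟩
        ∣ D ∣                             ≤⟨ size ⟩
        m + m                             ≡⟨ sym (cong₂ _+_ (∑ℕ-complement m c (χ≤1 D) 3) (∑ℕ-complement m c (χ≤1 D) (3 + m))) ⟩
        (l₁ + L₁) + (l₂ + L₂)             ≡⟨ +-interchange l₁ L₁ l₂ L₂ ⟩
        l₁ + l₂ + (L₁ + L₂)               ∎)
      where
      open ≤-Reasoning
      regroup : ∀ a b c d e → a + b + c + (d + e) ≡ a + (b + d) + (c + e)
      regroup = solve-∀

  F-lower : ∀ B D → IsPDom p (G ⊕ B) D → ∣ D ∣ ≤ m + m → p + 1 ≤ edgeCount B
  F-lower B D dom size = begin
      p + 1
    ≡⟨ +-comm p 1 ⟩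
      4 + q
    ≤⟨ F-arith q (c 0) (c 1) (c 2) l₁ l₂ (χ≤1 D 0) (χ≤1 D 1) (χ≤1 D 2) (few-in-D size) ⟩
      F-total q (c 0) (c 1) (c 2) l₁ l₂
    ≡⟨ sym (cong₂ _+_ (cong (X +_) (starDeficit≡ m (c 0) (c 1) l₁ L₁ (χ≤1 D 0) (χ≤1 D 1) (∑ℕ-complement m c (χ≤1 D) 3)))
                      (starDeficit≡ m (c 0) (c 2) l₂ L₂ (χ≤1 D 0) (χ≤1 D 2) (∑ℕ-complement m c (χ≤1 D) (3 + m)))) ⟩
      X + starDeficit m (c 0) (c 1) l₁ L₁ + starDeficit m (c 0) (c 2) l₂ L₂
    ≤⟨ +-mono-≤ (+-mono-≤ deficit-x (+-mono-≤ deficit-x₁ deficit-leaves₁)) (+-mono-≤ deficit-x₂ deficit-leaves₂) ⟩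
      f 0 + (f 1 + ∑ℕ m (λ k → f (3 + k))) + (f 2 + ∑ℕ m (λ k → f (3 + m + k)))
    ≡⟨ sym (∑ℕ-F f) ⟩
      ∑ℕ n f
    ≤⟨ ∑deficit≤edgeCount p G B D dom ⟩
      edgeCount B
    ∎ where
    open ≤-Reasoning
    open Deficits D
    X : ℕ
    X = (1 ∸ c 0) * (p ∸ (c 1 + c 2))

  adj-x₁ : ∀ w j → toℕ w ≡ 1 → InBlock 0 1 (toℕ j) ⊎ InBlock 3 m (toℕ j) → adj G w j ≡ true
  adj-x₁ w j ew (inj₁ at0) = F-adj-intro w j (≢-via ew (InBlock-point at0) (λ ())) (inj₂ (inj₁ (InBlock-point at0 , inj₁ ew)))
  adj-x₁ w j ew (inj₂ (lo , hi)) =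
    F-adj-intro w j (λ e → ≤⇒≯ lo (subst (_< 3) (trans (sym ew) e) (s≤s (s≤s z≤n))))
      (inj₁ (inj₂ (inj₁ (ew , lo , s≤s⁻¹ (≤-trans hi (≤-reflexive (cong suc (+-comm 1 p))))))))

  adj-x₂ : ∀ w j → toℕ w ≡ 2 → InBlock 0 1 (toℕ j) ⊎ InBlock (3 + m) m (toℕ j) → adj G w j ≡ true
  adj-x₂ w j ew (inj₁ at0) = F-adj-intro w j (≢-via ew (InBlock-point at0) (λ ())) (inj₂ (inj₁ (InBlock-point at0 , inj₂ ew)))
  adj-x₂ w j ew (inj₂ (lo , hi)) =
    F-adj-intro w j (λ e → ≤⇒≯ lo (subst (_< 3 + m) (trans (sym ew) e) (s≤s (s≤s (s≤s z≤n)))))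
      (inj₁ (inj₂ (inj₂ (ew , subst (_≤ toℕ j) (+-comm 2 p) lo , s≤s⁻¹ (≤-trans hi (≤-reflexive (sym n≡3+m+m)))))))

  -- The p-dominating set D₀ = {x} ∪ leaves, of size 2p - 1.
  inD₀ᵇ : ℕ → Bool
  inD₀ᵇ v = (v ≡ᵇ 0) ∨ (3 ≤ᵇ v)

  D₀ : Subset n
  D₀ = tabulate (λ j → inD₀ᵇ (toℕ j))

  χD₀ : ∀ v → v < n → χ D₀ v ≡ bit (inD₀ᵇ v)
  χD₀ = χ-tabulate inD₀ᵇ

  D₀-leaves₁ : ∀ k → k < m → χ D₀ (3 + k) ≡ 1
  D₀-leaves₁ k k<m = χD₀ (3 + k) (leaf₁<n k<m)

  D₀-leaves₂ : ∀ k → k < m → χ D₀ (3 + m + k) ≡ 1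
  D₀-leaves₂ k k<m = χD₀ (3 + m + k) (leaf₂<n k<m)

  D₀-x : ∀ k → k < 1 → χ D₀ (0 + k) ≡ 1
  D₀-x .0 (s≤s z≤n) = χD₀ 0 (s≤s z≤n)

  ∣D₀∣ : ∣ D₀ ∣ ≡ suc (m + m)
  ∣D₀∣ = begin
      ∣ D₀ ∣
    ≡⟨ ∣∣≡∑ℕχ D₀ ⟩
      ∑ℕ n (χ D₀)
    ≡⟨ ∑ℕ-F (χ D₀) ⟩
      χ D₀ 0 + (χ D₀ 1 + ∑ℕ m (λ k → χ D₀ (3 + k))) + (χ D₀ 2 + ∑ℕ m (λ k → χ D₀ (3 + m + k)))
    ≡⟨ cong₂ _+_ (cong₂ _+_ (χD₀ 0 (s≤s z≤n)) (cong₂ _+_ (χD₀ 1 (s≤s (s≤s z≤n))) (∑ℕ-ones m _ D₀-leaves₁)))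
                 (cong₂ _+_ (χD₀ 2 (s≤s (s≤s (s≤s z≤n)))) (∑ℕ-ones m _ D₀-leaves₂)) ⟩
      suc (m + m)
    ∎ where open ≡-Reasoning

  outside-D₀ : ∀ a → inD₀ᵇ a ≡ false → a ≡ 1 ⊎ a ≡ 2
  outside-D₀ 1 _ = inj₁ refl
  outside-D₀ 2 _ = inj₂ refl
  outside-D₀ 0 ()
  outside-D₀ (suc (suc (suc _))) ()

  D₀-dominates : IsPDom p G D₀
  D₀-dominates v v∉ with outside-D₀ (toℕ v) (trans (sym (lookup∘tabulate (λ j → inD₀ᵇ (toℕ j)) v)) (∉⇒lookup D₀ v v∉))
  ... | inj₁ ev = two-blocks-dominate G D₀ v 0 1 3 m (s≤s z≤n) 3+m≤n (λ j → adj-x₁ v j ev) D₀-x D₀-leaves₁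
  ... | inj₂ ev = two-blocks-dominate G D₀ v 0 1 (3 + m) m (s≤s z≤n) 3+m+m≤n (λ j → adj-x₂ v j ev) D₀-x D₀-leaves₂

  -- The reinforcing set B₀: join the leaf 3 of x₁ to x and to all leaves of x₂,
  -- and x₁ to the leaf 3 + m of x₂ (p + 1 edges).
  B₀-edgeᵇ : ℕ → ℕ → Bool
  B₀-edgeᵇ a b = ((a ≡ᵇ 3) ∧ ((b ≡ᵇ 0) ∨ inRange (3 + m) (2 + m + m) b)) ∨ ((a ≡ᵇ 1) ∧ (b ≡ᵇ 3 + m))

  B₀-edge : ℕ → ℕ → Set
  B₀-edge a b = (a ≡ 3 × (b ≡ 0 ⊎ InBlock (3 + m) m b)) ⊎ (a ≡ 1 × b ≡ 3 + m)

  B₀-edge-sound : ∀ a b → B₀-edgeᵇ a b ≡ true → B₀-edge a b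
  B₀-edge-sound a b h with ∨-true _ _ h
  ... | inj₂ h₂ with ∧-true _ _ h₂
  ...   | x , y = inj₂ (≡ᵇ-true a 1 x , ≡ᵇ-true b (3 + m) y)
  B₀-edge-sound a b h | inj₁ h₁ with ∧-true _ _ h₁
  ... | x , y with ∨-true _ _ y
  ...   | inj₁ z = inj₁ (≡ᵇ-true a 3 x , inj₁ (≡ᵇ-true b 0 z))
  ...   | inj₂ z with inRange-true (3 + m) (2 + m + m) b z
  ...     | lo , hi = inj₁ (≡ᵇ-true a 3 x , inj₂ (lo , s≤s hi))

  B₀-edge-complete : ∀ a b → B₀-edge a b → B₀-edgeᵇ a b ≡ true
  B₀-edge-complete a b (inj₁ (x , inj₁ y)) = ∨-introˡ _ (∧-intro (≡ᵇ-intro a 3 x) (∨-introˡ _ (≡ᵇ-intro b 0 y)))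
  B₀-edge-complete a b (inj₁ (x , inj₂ (lo , hi))) =
    ∨-introˡ _ (∧-intro (≡ᵇ-intro a 3 x) (∨-introʳ (b ≡ᵇ 0) (inRange-intro (3 + m) (2 + m + m) b lo (s≤s⁻¹ hi))))
  B₀-edge-complete a b (inj₂ (x , y)) = ∨-introʳ _ (∧-intro (≡ᵇ-intro a 1 x) (≡ᵇ-intro b (3 + m) y))

  B₀ : Graph n
  B₀ = fromEdges n B₀-edgeᵇ

  B₀-adj : ∀ i j → adj B₀ i j ≡ true → B₀-edge (toℕ i) (toℕ j) ⊎ B₀-edge (toℕ j) (toℕ i)
  B₀-adj i j h with fromEdges-adj n B₀-edgeᵇ i j h
  ... | inj₁ e = inj₁ (B₀-edge-sound (toℕ i) (toℕ j) e)
  ... | inj₂ e = inj₂ (B₀-edge-sound (toℕ j) (toℕ i) e)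

  B₀-nbhd-at : ∀ {a} w j → toℕ w ≡ a → adj B₀ w j ≡ true → B₀-edge a (toℕ j) ⊎ B₀-edge (toℕ j) a
  B₀-nbhd-at w j refl h = B₀-adj w j h

  B₀-adj-intro : ∀ i j → toℕ i ≢ toℕ j → B₀-edge (toℕ i) (toℕ j) → adj B₀ i j ≡ true
  B₀-adj-intro i j ne e = fromEdges-intro n B₀-edgeᵇ i j ne (inj₁ (B₀-edge-complete _ _ e))

  nbB₀-x₁ : ∀ b → B₀-edge 1 b ⊎ B₀-edge b 1 → b ≡ 3 + m
  nbB₀-x₁ b (inj₁ (inj₁ (() , _)))
  nbB₀-x₁ b (inj₁ (inj₂ (_ , e))) = e
  nbB₀-x₁ b (inj₂ (inj₁ (_ , inj₁ ())))
  nbB₀-x₁ b (inj₂ (inj₁ (_ , inj₂ (s≤s () , _))))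
  nbB₀-x₁ b (inj₂ (inj₂ (_ , ())))

  nbB₀-leaf : ∀ b → B₀-edge 3 b ⊎ B₀-edge b 3 → InBlock 0 1 b ⊎ InBlock (3 + m) m b
  nbB₀-leaf b (inj₁ (inj₁ (_ , inj₁ refl))) = inj₁ (z≤n , s≤s z≤n)
  nbB₀-leaf b (inj₁ (inj₁ (_ , inj₂ block))) = inj₂ block
  nbB₀-leaf b (inj₁ (inj₂ (() , _)))
  nbB₀-leaf b (inj₂ (inj₁ (_ , inj₁ ())))
  nbB₀-leaf b (inj₂ (inj₁ (_ , inj₂ (s≤s (s≤s (s≤s ())) , _))))
  nbB₀-leaf b (inj₂ (inj₂ (_ , ())))

  B₀-edge-source : ∀ {a b} → B₀-edge a b → a ≡ 3 ⊎ a ≡ 1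
  B₀-edge-source (inj₁ (e₃ , _)) = inj₁ e₃
  B₀-edge-source (inj₂ (e₁ , _)) = inj₂ e₁

  B₀-touches : ∀ i j → adj B₀ i j ≡ true → Touches 3 1 i ⊎ Touches 3 1 j
  B₀-touches i j h with B₀-adj i j h
  ... | inj₁ e = inj₁ (B₀-edge-source e)
  ... | inj₂ e = inj₂ (B₀-edge-source e)

  -- |E(B₀)| ≤ deg(3) + deg(x₁) = p + 1
  ∣B₀∣≤ : edgeCount B₀ ≤ p + 1
  ∣B₀∣≤ = ≤-trans
    (edgeCount≤two-stars B₀ 3 1 (λ u → ind 0 1 u + ind (3 + m) m u) (ind (3 + m) 1) (s≤s (s≤s (s≤s (s≤s z≤n)))) (s≤s (s≤s z≤n))
       B₀-touches
       (λ w ew j h → in-blocks (nbB₀-leaf (toℕ j) (B₀-nbhd-at w j ew h)))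
       (λ w ew j h → ≤-reflexive (sym (trans (cong (ind (3 + m) 1) (nbB₀-x₁ (toℕ j) (B₀-nbhd-at w j ew h))) (ind-at (3 + m))))))
    (≤-reflexive (cong₂ _+_ (trans (∑ℕ-+ n (ind 0 1) (ind (3 + m) m))
                                   (cong₂ _+_ (∑ℕ-ind n 0 1 (s≤s z≤n)) (∑ℕ-ind n (3 + m) m 3+m+m≤n)))
                            (∑ℕ-ind n (3 + m) 1 (≤-trans (+-monoʳ-≤ (3 + m) (s≤s z≤n)) 3+m+m≤n))))

  B₀-new-edges : ∀ a b → B₀-edge a b → F-edge a b ⊎ F-edge b a → ⊥
  B₀-new-edges .3 b (inj₁ (refl , end)) f with nb-leaf₁ 3 b (s≤s (s≤s (s≤s z≤n))) (s≤s (s≤s (s≤s z≤n))) f | end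
  ... | refl | inj₁ ()
  ... | refl | inj₂ (s≤s () , _)
  B₀-new-edges .1 .(3 + m) (inj₂ (refl , refl)) f with nb-x₁ (3 + m) f
  ... | inj₁ ()
  ... | inj₂ (_ , hi) = ≤⇒≯ hi (≤-reflexive (cong suc (+-comm p 1)))

  B₀∩G=∅ : Disjoint B₀ G
  B₀∩G=∅ i j h = ¬-not (λ g → either (B₀-adj i j h) (F-adj i j g))
    where
    either : B₀-edge (toℕ i) (toℕ j) ⊎ B₀-edge (toℕ j) (toℕ i) → F-edge (toℕ i) (toℕ j) ⊎ F-edge (toℕ j) (toℕ i) → ⊥
    either (inj₁ e) f = B₀-new-edges _ _ e f
    either (inj₂ e) f = B₀-new-edges _ _ e (swap f)

  -- D₁ = D₀ minus the leaf 3 p-dominates G ⊕ B₀ and has 2p - 2 vertices.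
  GB₀ : Graph n
  GB₀ = G ⊕ B₀

  via-G : ∀ w j → adj G w j ≡ true → adj GB₀ w j ≡ true
  via-G w j h = ∨-introˡ (adj B₀ w j) h

  via-B₀ : ∀ w j → adj B₀ w j ≡ true → adj GB₀ w j ≡ true
  via-B₀ w j h = ∨-introʳ (adj G w j) h

  inD₁ᵇ : ℕ → Bool
  inD₁ᵇ v = (v ≡ᵇ 0) ∨ (4 ≤ᵇ v)

  D₁ : Subset n
  D₁ = tabulate (λ j → inD₁ᵇ (toℕ j))

  χD₁ : ∀ v → v < n → χ D₁ v ≡ bit (inD₁ᵇ v)
  χD₁ = χ-tabulate inD₁ᵇ

  D₁-x : ∀ k → k < 1 → χ D₁ (0 + k) ≡ 1
  D₁-x .0 (s≤s z≤n) = χD₁ 0 (s≤s z≤n)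

  D₁-from-4 : ∀ k → k < m → χ D₁ (4 + k) ≡ 1
  D₁-from-4 k k<m = χD₁ (4 + k) (≤-trans (s≤s (s≤s (s≤s (s≤s k<m)))) 4+m≤n)

  D₁-leaves₂ : ∀ k → k < m → χ D₁ (3 + m + k) ≡ 1
  D₁-leaves₂ k k<m = χD₁ (3 + m + k) (leaf₂<n k<m)

  ∣D₁∣ : ∣ D₁ ∣ ≡ m + m
  ∣D₁∣ = begin
      ∣ D₁ ∣
    ≡⟨ ∣∣≡∑ℕχ D₁ ⟩
      ∑ℕ n (χ D₁)
    ≡⟨ ∑ℕ-F (χ D₁) ⟩
      χ D₁ 0 + (χ D₁ 1 + (χ D₁ 3 + ∑ℕ (suc q) (λ k → χ D₁ (4 + k)))) + (χ D₁ 2 + ∑ℕ m (λ k → χ D₁ (3 + m + k)))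
    ≡⟨ cong₂ _+_ (cong₂ _+_ (χD₁ 0 (s≤s z≤n)) (cong₂ _+_ (χD₁ 1 (s≤s (s≤s z≤n)))
                   (cong₂ _+_ (χD₁ 3 (s≤s (s≤s (s≤s (s≤s z≤n)))))
                              (∑ℕ-ones (suc q) _ (λ k k<q → D₁-from-4 k (≤-trans k<q (n≤1+n _)))))))
                 (cong₂ _+_ (χD₁ 2 (s≤s (s≤s (s≤s z≤n)))) (∑ℕ-ones m _ D₁-leaves₂)) ⟩
      m + m
    ∎ where open ≡-Reasoning

  outside-D₁ : ∀ a → inD₁ᵇ a ≡ false → a ≡ 1 ⊎ a ≡ 2 ⊎ a ≡ 3
  outside-D₁ 1 _ = inj₁ refl
  outside-D₁ 2 _ = inj₂ (inj₁ refl)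
  outside-D₁ 3 _ = inj₂ (inj₂ refl)
  outside-D₁ 0 ()
  outside-D₁ (suc (suc (suc (suc _)))) ()

  -- x₁ sees x, its leaves 4, …, p + 1 and, through B₀, the leaf 3 + m
  x₁-in-GB₀ : ∀ w j → toℕ w ≡ 1 → InBlock 0 1 (toℕ j) ⊎ InBlock 4 m (toℕ j) → adj GB₀ w j ≡ true
  x₁-in-GB₀ w j ew (inj₁ at0) = via-G w j (adj-x₁ w j ew (inj₁ at0))
  x₁-in-GB₀ w j ew (inj₂ (lo , hi)) with toℕ j ≤? p + 1
  ... | yes j≤p+1 =
    via-G w j (adj-x₁ w j ew (inj₂ (≤-trans (n≤1+n 3) lo , ≤-trans (s≤s j≤p+1) (≤-reflexive (cong suc (+-comm p 1))))))
  ... | no j≰p+1 = via-B₀ w j (B₀-adj-intro w j (λ e → ≤⇒≯ lo (subst (_< 4) (trans (sym ew) e) (s≤s (s≤s z≤n))))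
                     (inj₂ (ew , ≤-antisym (s≤s⁻¹ hi) (subst (_≤ toℕ j) (cong suc (+-comm p 1)) (≰⇒> j≰p+1)))))

  -- the leaf 3 sees, through B₀, x and all leaves of x₂
  leaf₃-in-GB₀ : ∀ w j → toℕ w ≡ 3 → InBlock 0 1 (toℕ j) ⊎ InBlock (3 + m) m (toℕ j) → adj GB₀ w j ≡ true
  leaf₃-in-GB₀ w j ew (inj₁ at0) =
    via-B₀ w j (B₀-adj-intro w j (≢-via ew (InBlock-point at0) (λ ())) (inj₁ (ew , inj₁ (InBlock-point at0))))
  leaf₃-in-GB₀ w j ew (inj₂ block) =
    via-B₀ w j (B₀-adj-intro w j (λ e → ≤⇒≯ (proj₁ block) (subst (_< 3 + m) (trans (sym ew) e) (s≤s (s≤s (s≤s (s≤s z≤n))))))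
                  (inj₁ (ew , inj₂ block)))

  D₁-dominates : IsPDom p GB₀ D₁
  D₁-dominates v v∉ with outside-D₁ (toℕ v) (trans (sym (lookup∘tabulate (λ j → inD₁ᵇ (toℕ j)) v)) (∉⇒lookup D₁ v v∉))
  ... | inj₁ ev = two-blocks-dominate GB₀ D₁ v 0 1 4 m (s≤s z≤n) 4+m≤n
                    (λ j → x₁-in-GB₀ v j ev) D₁-x D₁-from-4
  ... | inj₂ (inj₁ ev) = two-blocks-dominate GB₀ D₁ v 0 1 (3 + m) m (s≤s z≤n) 3+m+m≤n
                           (λ j h → via-G v j (adj-x₂ v j ev h)) D₁-x D₁-leaves₂
  ... | inj₂ (inj₂ ev) = two-blocks-dominate GB₀ D₁ v 0 1 (3 + m) m (s≤s z≤n) 3+m+m≤n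
                           (λ j → leaf₃-in-GB₀ v j ev) D₁-x D₁-leaves₂

  F-rp : IsRP p G (p + 1)
  F-rp = rp-from-bounds p G (suc (m + m)) (p + 1) p<γ (s≤s z≤n) (D₀ , D₀-dominates , ∣D₀∣)
           (λ B D dom small → F-lower B D dom (s≤s⁻¹ small))
           B₀ B₀∩G=∅ ∣B₀∣≤ (D₁ , D₁-dominates , ≤-reflexive (cong suc ∣D₁∣))
    where
    p<γ : p < suc (m + m)
    p<γ = s≤s (+-monoˡ-≤ m (s≤s (z≤n {suc q})))

-- Branch i of
-- the centre x consists of yᵢ (in D iff a = 1), xᵢ (iff b = 1) and the leaves
-- of xᵢ, L in D and ℓ outside; c₀ records x ∈ D.  Its total deficit is that of
-- yᵢ, (1 - a)(p - c₀ - b), plus that of the star at xᵢ.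
branchDeficit : ℕ → ℕ → ℕ → ℕ → ℕ → ℕ → ℕ
branchDeficit M c₀ a b ℓ L = (1 ∸ a) * (suc M ∸ (c₀ + b)) + starDeficit M a b ℓ L

branch-sparse : ∀ M a b ℓ L → 2 ≤ M → a ≤ 1 → b ≤ 1 → ℓ + L ≡ M → a + b + L ≤ M →
  M + 2 ≤ branchDeficit M 0 a b ℓ L
branch-sparse M a b ℓ L 2≤M a≤1 b≤1 ℓ+L≡M few
  rewrite starDeficit≡ M a b ℓ L a≤1 b≤1 ℓ+L≡M with a≤1 | b≤1 | ℓ+L≡M
... | s≤s z≤n | s≤s z≤n | refl = begin
    ℓ + L + 2          ≤⟨ +-monoʳ-≤ (ℓ + L) 2≤M ⟩
    ℓ + L + (ℓ + L)    ≡⟨ sym (cong ((ℓ + L) +_) (+-identityʳ (ℓ + L))) ⟩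
    2 * (ℓ + L)        ≤⟨ *-monoˡ-≤ (ℓ + L) (+-cancelʳ-≤ L 2 ℓ few) ⟩
    ℓ * (ℓ + L)        ≡⟨ sym (+-identityʳ _) ⟩
    ℓ * (ℓ + L) + 0    ∎ where open ≤-Reasoning
... | s≤s z≤n | z≤n | refl = begin
    ℓ + L + 2                      ≡⟨ sym (*-identityˡ (ℓ + L + 2)) ⟩
    1 * (ℓ + L + 2)                ≤⟨ *-monoˡ-≤ (ℓ + L + 2) (+-cancelʳ-≤ L 1 ℓ few) ⟩
    ℓ * (ℓ + L + 2)                ≡⟨ lemma ℓ L ⟩
    0 + (ℓ * (ℓ + L) + 1 * (ℓ + ℓ + 0))  ∎
  where
  open ≤-Reasoning
  lemma : ∀ ℓ L → ℓ * (ℓ + L + 2) ≡ 0 + (ℓ * (ℓ + L) + 1 * (ℓ + ℓ + 0))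
  lemma = solve-∀
... | z≤n | s≤s z≤n | refl = begin
    ℓ + L + 2                      ≤⟨ +-monoʳ-≤ (ℓ + L) 2≤M ⟩
    ℓ + L + (ℓ + L)                ≡⟨ cong (ℓ + L +_) (sym (*-identityˡ (ℓ + L))) ⟩
    ℓ + L + 1 * (ℓ + L)            ≤⟨ +-monoʳ-≤ (ℓ + L) (*-monoˡ-≤ (ℓ + L) (+-cancelʳ-≤ L 1 ℓ few)) ⟩
    ℓ + L + ℓ * (ℓ + L)            ≡⟨ lemma ℓ L ⟩
    1 * (suc (ℓ + L) ∸ (0 + 1)) + (ℓ * (ℓ + L) + 0)  ∎
  where
  open ≤-Reasoning
  lemma : ∀ ℓ L → ℓ + L + ℓ * (ℓ + L) ≡ 1 * (ℓ + L) + (ℓ * (ℓ + L) + 0)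
  lemma = solve-∀
... | z≤n | z≤n | refl = ≤-by (ℓ * (ℓ + L) + ℓ + ℓ) (lemma ℓ L)
  where
  lemma : ∀ ℓ L → 1 * suc (ℓ + L) + (ℓ * (ℓ + L) + 1 * (ℓ + ℓ + 1)) ≡ ℓ + L + 2 + (ℓ * (ℓ + L) + ℓ + ℓ)
  lemma = solve-∀

-- with x ∈ D, each branch satisfies deficit + M·|D ∩ branch| ≥ M (M + 1):
-- every vertex of the branch missing from D costs M in deficit
branch-dense : ∀ M a b ℓ L → a ≤ 1 → b ≤ 1 → ℓ + L ≡ M →
  M * suc M ≤ branchDeficit M 1 a b ℓ L + M * (a + b + L)
branch-dense M a b ℓ L a≤1 b≤1 ℓ+L≡M
  rewrite starDeficit≡ M a b ℓ L a≤1 b≤1 ℓ+L≡M with a≤1 | b≤1 | ℓ+L≡M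
... | s≤s z≤n | s≤s z≤n | refl = ≤-by (ℓ + L) (lemma ℓ L)
  where
  lemma : ∀ ℓ L → 0 + (ℓ * (ℓ + L) + 0) + (ℓ + L) * (1 + 1 + L) ≡ (ℓ + L) * suc (ℓ + L) + (ℓ + L)
  lemma = solve-∀
... | s≤s z≤n | z≤n | refl = ≤-by (ℓ + ℓ) (lemma ℓ L)
  where
  lemma : ∀ ℓ L → 0 + (ℓ * (ℓ + L) + 1 * (ℓ + ℓ + 0)) + (ℓ + L) * (1 + 0 + L) ≡ (ℓ + L) * suc (ℓ + L) + (ℓ + ℓ)
  lemma = solve-∀
... | z≤n | s≤s z≤n | refl = ≤-by (ℓ + L ∸ 1) (lemma ℓ L (ℓ + L ∸ 1))
  where
  lemma : ∀ ℓ L X → 1 * X + (ℓ * (ℓ + L) + 0) + (ℓ + L) * (0 + 1 + L) ≡ (ℓ + L) * suc (ℓ + L) + X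
  lemma = solve-∀
... | z≤n | z≤n | refl = ≤-by (ℓ + ℓ + 1) (lemma ℓ L)
  where
  lemma : ∀ ℓ L → 1 * (ℓ + L) + (ℓ * (ℓ + L) + 1 * (ℓ + ℓ + 1)) + (ℓ + L) * (0 + 0 + L) ≡ (ℓ + L) * suc (ℓ + L) + (ℓ + ℓ + 1)
  lemma = solve-∀

-- If D has fewer than t·p vertices, the branch deficits total at least p + 1.
-- With x ∉ D some branch holds at most M vertices of D (pigeonhole); with x ∈ D
-- the branches hold at most t·p - 2 vertices and branch-dense sums to 2M ≥ p + 1.
Ft-arith : ∀ t M c₀ (a b ℓ L : ℕ → ℕ) → 2 ≤ M → c₀ ≤ 1 →
  (∀ i → i < t → a i ≤ 1) → (∀ i → i < t → b i ≤ 1) → (∀ i → i < t → ℓ i + L i ≡ M) →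
  c₀ + ∑ℕ t (λ i → a i + b i + L i) < t * suc M →
  M + 2 ≤ ∑ℕ t (λ i → branchDeficit M c₀ (a i) (b i) (ℓ i) (L i))
Ft-arith t M _ a b ℓ L 2≤M z≤n a≤1 b≤1 ℓ+L≡M size with ∑ℕ-pigeonhole t (suc M) (λ i → a i + b i + L i) size
... | i , i<t , sparse =
  ≤-trans (branch-sparse M (a i) (b i) (ℓ i) (L i) 2≤M (a≤1 i i<t) (b≤1 i i<t) (ℓ+L≡M i i<t) (s≤s⁻¹ sparse))
          (∑ℕ-term t _ i i<t)
Ft-arith t M _ a b ℓ L 2≤M (s≤s z≤n) a≤1 b≤1 ℓ+L≡M size = begin
    M + 2    ≤⟨ +-monoʳ-≤ M 2≤M ⟩
    M + M    ≡⟨ cong (M +_) (sym (+-identityʳ M)) ⟩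
    2 * M    ≤⟨ +-cancelˡ-≤ (M * S) (2 * M) Δ key ⟩
    Δ        ∎
  where
  open ≤-Reasoning
  S Δ : ℕ
  S = ∑ℕ t (λ i → a i + b i + L i)
  Δ = ∑ℕ t (λ i → branchDeficit M 1 (a i) (b i) (ℓ i) (L i))
  summed : t * (M * suc M) ≤ Δ + M * S
  summed = begin
      t * (M * suc M)                   ≡⟨ sym (∑ℕ-const t (M * suc M)) ⟩
      ∑ℕ t (λ _ → M * suc M)
        ≤⟨ ∑ℕ-mono t (λ i i<t → branch-dense M (a i) (b i) (ℓ i) (L i) (a≤1 i i<t) (b≤1 i i<t) (ℓ+L≡M i i<t)) ⟩
      ∑ℕ t (λ i → branchDeficit M 1 (a i) (b i) (ℓ i) (L i) + M * (a i + b i + L i))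
        ≡⟨ trans (∑ℕ-+ t _ _) (cong (Δ +_) (∑ℕ-*ˡ t M _)) ⟩
      Δ + M * S                         ∎
  key : M * S + 2 * M ≤ M * S + Δ
  key = begin
      M * S + 2 * M        ≡⟨ lemma M S ⟩
      M * (S + 2)          ≤⟨ *-monoʳ-≤ M (≤-trans (≤-reflexive (+-comm S 2)) size) ⟩
      M * (t * suc M)      ≡⟨ rotate M t ⟩
      t * (M * suc M)      ≤⟨ summed ⟩
      Δ + M * S            ≡⟨ +-comm Δ (M * S) ⟩
      M * S + Δ            ∎
    where
    lemma : ∀ M S → M * S + 2 * M ≡ M * (S + 2)
    lemma = solve-∀
    rotate : ∀ M t → M * (t * suc M) ≡ t * (M * suc M)
    rotate = solve-∀

-- The tree F_{t,p-1}, p = q + 3 ≤ t, m = p - 1.  Vertices (Defs.Ft): the centre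
-- x = 0, yᵢ = 1 + i, xᵢ = 1 + t + i, and the leaves of xᵢ are vleaf i + k
-- (i < t, k < m), where vleaf i = 1 + 2t + i·m.
module Ft-tree (q t : ℕ) (p≤t : 3 + q ≤ t) where
  m p n : ℕ
  m = 2 + q
  p = 1 + m
  n = suc (t + t + t * (p ∸ 1))

  G : Graph n
  G = Ft t p

  vy vx vleaf : ℕ → ℕ
  vy i = suc i
  vx i = suc (t + i)
  vleaf i = suc (t + t + i * m)

  lo hi : ℕ → ℕ
  lo a = t + t + 1 + (a ∸ (t + 1)) * m
  hi a = t + t + (a ∸ t) * m

  x-edgeᵇ y-edgeᵇ leaf-edgeᵇ Ft-edgeᵇ : ℕ → ℕ → Bool
  x-edgeᵇ a b = (a ≡ᵇ 0) ∧ inRange 1 t b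
  y-edgeᵇ a b = inRange 1 t a ∧ (b ≡ᵇ a + t)
  leaf-edgeᵇ a b = inRange (t + 1) (t + t) a ∧ inRange (lo a) (hi a) b
  Ft-edgeᵇ a b = x-edgeᵇ a b ∨ y-edgeᵇ a b ∨ leaf-edgeᵇ a b

  Ft-edge : ℕ → ℕ → Set
  Ft-edge a b = (a ≡ 0 × 1 ≤ b × b ≤ t) ⊎ (1 ≤ a × a ≤ t × b ≡ a + t)
              ⊎ ((t + 1 ≤ a × a ≤ t + t) × (lo a ≤ b × b ≤ hi a))

  Ft-edge-sound : ∀ a b → Ft-edgeᵇ a b ≡ true → Ft-edge a b
  Ft-edge-sound a b h with ∨-true _ _ h
  ... | inj₁ h₀ with ∧-true _ _ h₀
  ...   | x , y = inj₁ (≡ᵇ-true a 0 x , inRange-true 1 t b y)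
  Ft-edge-sound a b h | inj₂ h' with ∨-true _ _ h'
  ... | inj₁ h₁ with ∧-true _ _ h₁
  ...   | x , y with inRange-true 1 t a x
  ...     | u , v = inj₂ (inj₁ (u , v , ≡ᵇ-true b (a + t) y))
  Ft-edge-sound a b h | inj₂ h' | inj₂ h₂ with ∧-true _ _ h₂
  ...   | x , y = inj₂ (inj₂ (inRange-true (t + 1) (t + t) a x , inRange-true (lo a) (hi a) b y))

  Ft-edge-complete : ∀ a b → Ft-edge a b → Ft-edgeᵇ a b ≡ true
  Ft-edge-complete a b (inj₁ (x , u , v)) = ∨-introˡ _ (∧-intro (≡ᵇ-intro a 0 x) (inRange-intro 1 t b u v))
  Ft-edge-complete a b (inj₂ (inj₁ (u , v , y))) =
    ∨-introʳ (x-edgeᵇ a b) (∨-introˡ _ (∧-intro (inRange-intro 1 t a u v) (≡ᵇ-intro b (a + t) y)))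
  Ft-edge-complete a b (inj₂ (inj₂ ((u , v) , (x , y)))) =
    ∨-introʳ (x-edgeᵇ a b) (∨-introʳ (y-edgeᵇ a b) (∧-intro (inRange-intro (t + 1) (t + t) a u v) (inRange-intro (lo a) (hi a) b x y)))

  Ft-adj : ∀ i j → adj G i j ≡ true → Ft-edge (toℕ i) (toℕ j) ⊎ Ft-edge (toℕ j) (toℕ i)
  Ft-adj i j h with fromEdges-adj n Ft-edgeᵇ i j h
  ... | inj₁ e = inj₁ (Ft-edge-sound (toℕ i) (toℕ j) e)
  ... | inj₂ e = inj₂ (Ft-edge-sound (toℕ j) (toℕ i) e)

  Ft-nbhd-at : ∀ {a} w j → toℕ w ≡ a → adj G w j ≡ true → Ft-edge a (toℕ j) ⊎ Ft-edge (toℕ j) a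
  Ft-nbhd-at w j refl h = Ft-adj w j h

  Ft-adj-intro : ∀ i j → toℕ i ≢ toℕ j → Ft-edge (toℕ i) (toℕ j) ⊎ Ft-edge (toℕ j) (toℕ i) → adj G i j ≡ true
  Ft-adj-intro i j ne (inj₁ e) = fromEdges-intro n Ft-edgeᵇ i j ne (inj₁ (Ft-edge-complete _ _ e))
  Ft-adj-intro i j ne (inj₂ e) = fromEdges-intro n Ft-edgeᵇ i j ne (inj₂ (Ft-edge-complete _ _ e))

  t+1≡ : t + 1 ≡ suc t
  t+1≡ = +-comm t 1

  t<vx : ∀ i → t < vx i
  t<vx i = s≤s (m≤m+n t i)

  vx≤t+t : ∀ {i} → i < t → vx i ≤ t + t
  vx≤t+t {i} i<t = ≤-trans (≤-reflexive (sym (+-suc t i))) (+-monoʳ-≤ t i<t)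

  vy+t : ∀ i → vy i + t ≡ vx i
  vy+t i = cong suc (+-comm i t)

  t+t<leaf : ∀ i k → t + t < vleaf i + k
  t+t<leaf i k = s≤s (≤-trans (m≤m+n (t + t) (i * m)) (m≤m+n _ k))

  t+t<lo : ∀ a → t + t < lo a
  t+t<lo a = ≤-trans (≤-reflexive (+-comm 1 (t + t))) (m≤m+n (t + t + 1) _)

  lo-vx : ∀ i → lo (vx i) ≡ vleaf i
  lo-vx i = trans (cong (λ z → t + t + 1 + z * m) (trans (cong (vx i ∸_) t+1≡) (m+n∸m≡n t i)))
                  (cong (_+ i * m) (+-comm (t + t) 1))

  hi-vx : ∀ i → suc (hi (vx i)) ≡ vleaf i + m
  hi-vx i = cong suc (trans (cong (λ z → t + t + z * m) (trans (cong (_∸ t) (sym (+-suc t i))) (m+n∸m≡n t (suc i))))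
                            (trans (cong (t + t +_) (+-comm m (i * m))) (sym (+-assoc (t + t) (i * m) m))))

  as-vx : ∀ a → t + 1 ≤ a → a ≤ t + t → Σ ℕ λ i → i < t × a ≡ vx i
  as-vx a lo≤a a≤hi = d , d<t , sym vx-d
    where
    d = a ∸ (t + 1)
    t+1+d : (t + 1) + d ≡ vx d
    t+1+d = trans (+-assoc t 1 d) (+-suc t d)
    vx-d : vx d ≡ a
    vx-d = trans (sym t+1+d) (m+[n∸m]≡n lo≤a)
    d<t : d < t
    d<t = +-cancelˡ-≤ t (suc d) t (≤-trans (≤-reflexive (+-suc t d)) (≤-trans (≤-reflexive (sym t+1+d))
            (≤-trans (≤-reflexive (m+[n∸m]≡n lo≤a)) a≤hi)))

  same-block : ∀ i i' k → k < m → i' * m ≤ i * m + k → i * m + k < suc i' * m → i' ≡ i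
  same-block i i' k k<m below above with <-cmp i i'
  ... | tri≈ _ e _ = sym e
  ... | tri< i<i' _ _ = ⊥-elim (≤⇒≯ (≤-trans (*-monoˡ-≤ m i<i') below)
          (≤-trans (≤-reflexive (+-comm 1 (i * m + k))) (≤-trans (≤-reflexive (+-assoc (i * m) k 1))
            (≤-trans (+-monoʳ-≤ (i * m) (≤-trans (≤-reflexive (+-comm k 1)) k<m)) (≤-reflexive (+-comm (i * m) m))))))
  ... | tri> _ _ i'<i = ⊥-elim (≤⇒≯ (≤-trans (*-monoˡ-≤ m i'<i) (m≤m+n (i * m) k)) above)

  nb-y : ∀ i b → i < t → Ft-edge (vy i) b ⊎ Ft-edge b (vy i) → b ≡ 0 ⊎ b ≡ vx i
  nb-y i b i<t (inj₁ (inj₁ (() , _)))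
  nb-y i b i<t (inj₁ (inj₂ (inj₁ (_ , _ , e)))) = inj₂ (trans e (vy+t i))
  nb-y i b i<t (inj₁ (inj₂ (inj₂ ((t+1≤ , _) , _)))) = ⊥-elim (≤⇒≯ i<t (subst (_≤ suc i) t+1≡ t+1≤))
  nb-y i b i<t (inj₂ (inj₁ (e , _))) = inj₁ e
  nb-y i b i<t (inj₂ (inj₂ (inj₁ (1≤b , _ , e)))) =
    ⊥-elim (≤⇒≯ i<t (≤-trans (+-monoˡ-≤ t 1≤b) (≤-reflexive (sym e))))
  nb-y i b i<t (inj₂ (inj₂ (inj₂ (_ , (lo≤ , _))))) = ⊥-elim (≤⇒≯ i<t (≤-trans (s≤s (m≤m+n t t)) (≤-trans (t+t<lo b) lo≤)))

  nb-x : ∀ i b → i < t → Ft-edge (vx i) b ⊎ Ft-edge b (vx i) → b ≡ vy i ⊎ InBlock (vleaf i) m b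
  nb-x i b i<t (inj₁ (inj₁ (() , _)))
  nb-x i b i<t (inj₁ (inj₂ (inj₁ (_ , ≤t , _)))) = ⊥-elim (≤⇒≯ ≤t (t<vx i))
  nb-x i b i<t (inj₁ (inj₂ (inj₂ (_ , (lo≤ , ≤hi))))) = inj₂ (subst (_≤ b) (lo-vx i) lo≤ , subst (b <_) (hi-vx i) (s≤s ≤hi))
  nb-x i b i<t (inj₂ (inj₁ (_ , _ , ≤t))) = ⊥-elim (≤⇒≯ ≤t (t<vx i))
  nb-x i b i<t (inj₂ (inj₂ (inj₁ (_ , _ , e)))) = inj₁ (+-cancelʳ-≡ t b (suc i) (trans (sym e) (sym (vy+t i))))
  nb-x i b i<t (inj₂ (inj₂ (inj₂ (_ , (lo≤ , _))))) = ⊥-elim (≤⇒≯ (vx≤t+t i<t) (<-≤-trans (t+t<lo b) lo≤))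

  nb-leaf : ∀ i k b → i < t → k < m → Ft-edge (vleaf i + k) b ⊎ Ft-edge b (vleaf i + k) → b ≡ vx i
  nb-leaf i k b i<t k<m (inj₁ (inj₁ (() , _)))
  nb-leaf i k b i<t k<m (inj₁ (inj₂ (inj₁ (_ , ≤t , _)))) = ⊥-elim (≤⇒≯ ≤t (≤-trans (s≤s (m≤m+n t t)) (t+t<leaf i k)))
  nb-leaf i k b i<t k<m (inj₁ (inj₂ (inj₂ ((_ , ≤t+t) , _)))) = ⊥-elim (≤⇒≯ ≤t+t (t+t<leaf i k))
  nb-leaf i k b i<t k<m (inj₂ (inj₁ (_ , _ , ≤t))) = ⊥-elim (≤⇒≯ ≤t (≤-trans (s≤s (m≤m+n t t)) (t+t<leaf i k)))
  nb-leaf i k b i<t k<m (inj₂ (inj₂ (inj₁ (_ , b≤t , e)))) = ⊥-elim (≤⇒≯ (≤-trans (≤-reflexive e) (+-monoˡ-≤ t b≤t)) (t+t<leaf i k))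
  nb-leaf i k b i<t k<m (inj₂ (inj₂ (inj₂ ((t+1≤b , b≤t+t) , (lo≤ , ≤hi))))) with as-vx b t+1≤b b≤t+t
  ... | i' , _ , refl = cong vx (same-block i i' k k<m below above)
    where
    below : i' * m ≤ i * m + k
    below = +-cancelˡ-≤ (t + t) _ _ (≤-trans (s≤s⁻¹ (subst (_≤ vleaf i + k) (lo-vx i') lo≤)) (≤-reflexive (+-assoc (t + t) (i * m) k)))
    above : i * m + k < suc i' * m
    above = +-cancelˡ-≤ (t + t) _ _ (≤-trans (≤-reflexive (trans (+-suc (t + t) (i * m + k)) (cong suc (sym (+-assoc (t + t) (i * m) k)))))
              (s≤s⁻¹ (≤-trans (s≤s ≤hi) (≤-reflexive (trans (hi-vx i') (cong suc (trans (+-assoc (t + t) (i' * m) m) (cong (t + t +_) (+-comm (i' * m) m)))))))))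

  centre-sees : ∀ w j → toℕ w ≡ 0 → InBlock 1 t (toℕ j) → adj G w j ≡ true
  centre-sees w j ew (lo , hi) =
    Ft-adj-intro w j (λ e → ≤⇒≯ lo (≤-reflexive (cong suc (trans (sym e) ew)))) (inj₁ (inj₁ (ew , lo , s≤s⁻¹ hi)))

  xᵢ-sees-yᵢ : ∀ i w j → i < t → toℕ w ≡ vx i → toℕ j ≡ vy i → adj G w j ≡ true
  xᵢ-sees-yᵢ i w j i<t ew ej =
    Ft-adj-intro w j (λ e → ≤⇒≯ i<t (subst (t <_) (trans (sym ew) (trans e ej)) (t<vx i)))
      (inj₂ (inj₂ (inj₁ (subst (1 ≤_) (sym ej) (s≤s z≤n) , subst (_≤ t) (sym ej) i<t ,
                         trans ew (trans (sym (vy+t i)) (cong (_+ t) (sym ej)))))))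

  xᵢ-sees-leaves : ∀ i w j → i < t → toℕ w ≡ vx i → InBlock (vleaf i) m (toℕ j) → adj G w j ≡ true
  xᵢ-sees-leaves i w j i<t ew (lo≤ , <hi) =
    Ft-adj-intro w j (λ e → ≤⇒≯ (subst (_≤ t + t) (trans (sym ew) e) (vx≤t+t i<t)) (<-≤-trans (t+t<leaf i 0) (≤-trans (≤-reflexive (+-identityʳ _)) lo≤)))
      (inj₁ (inj₂ (inj₂ ((subst (t + 1 ≤_) (sym ew) (≤-trans (≤-reflexive t+1≡) (t<vx i)) , subst (_≤ t + t) (sym ew) (vx≤t+t i<t)) ,
                          (subst (_≤ toℕ j) (sym (trans (cong lo ew) (lo-vx i))) lo≤ ,
                           s≤s⁻¹ (subst (toℕ j <_) (sym (trans (cong (λ a → suc (hi a)) ew) (hi-vx i))) <hi))))))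

  xᵢ-sees : ∀ i w j → i < t → toℕ w ≡ vx i → InBlock (vy i) 1 (toℕ j) ⊎ InBlock (vleaf i) m (toℕ j) → adj G w j ≡ true
  xᵢ-sees i w j i<t ew (inj₁ at-y) = xᵢ-sees-yᵢ i w j i<t ew (InBlock-point at-y)
  xᵢ-sees i w j i<t ew (inj₂ leaf) = xᵢ-sees-leaves i w j i<t ew leaf

  ∑ℕ-Ft : ∀ (f : ℕ → ℕ) → ∑ℕ n f ≡ f 0 + ∑ℕ t (λ i → f (vy i) + f (vx i) + ∑ℕ m (λ k → f (vleaf i + k)))
  ∑ℕ-Ft f = cong (f 0 +_) (begin
      ∑ℕ (t + t + t * m) g
    ≡⟨ ∑ℕ-split (t + t) (t * m) g ⟩
      ∑ℕ (t + t) g + ∑ℕ (t * m) (λ k → g (t + t + k))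
    ≡⟨ cong₂ _+_ (∑ℕ-split t t g) (∑ℕ-blocks t m (λ k → g (t + t + k))) ⟩
      ∑ℕ t (λ i → f (vy i)) + ∑ℕ t (λ i → f (vx i)) + ∑ℕ t (λ i → ∑ℕ m (λ k → f (suc (t + t + (i * m + k)))))
    ≡⟨ cong (∑ℕ t (λ i → f (vy i)) + ∑ℕ t (λ i → f (vx i)) +_)
            (∑ℕ-cong t (λ i _ → ∑ℕ-cong m (λ k _ → cong (λ z → f (suc z)) (sym (+-assoc (t + t) (i * m) k))))) ⟩
      ∑ℕ t (λ i → f (vy i)) + ∑ℕ t (λ i → f (vx i)) + ∑ℕ t (λ i → ∑ℕ m (λ k → f (vleaf i + k)))
    ≡⟨ sym (trans (∑ℕ-+ t _ _) (cong (_+ ∑ℕ t (λ i → ∑ℕ m (λ k → f (vleaf i + k)))) (∑ℕ-+ t _ _))) ⟩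
      ∑ℕ t (λ i → f (vy i) + f (vx i) + ∑ℕ m (λ k → f (vleaf i + k)))
    ∎)
    where
    open ≡-Reasoning
    g : ℕ → ℕ
    g k = f (suc k)

  im+k<tm : ∀ {i k} → i < t → k < m → i * m + k < t * m
  im+k<tm {i} {k} i<t k<m = ≤-trans (≤-trans (≤-reflexive (sym (+-suc (i * m) k))) (+-monoʳ-≤ (i * m) k<m))
                                    (≤-trans (≤-reflexive (+-comm (i * m) m)) (*-monoˡ-≤ m i<t))

  vy<n : ∀ {i} → i < t → vy i < n
  vy<n i<t = s≤s (≤-trans i<t (≤-trans (m≤m+n t t) (m≤m+n (t + t) _)))

  vx<n : ∀ {i} → i < t → vx i < n
  vx<n i<t = s≤s (≤-trans (vx≤t+t i<t) (m≤m+n (t + t) _))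

  leaf<n : ∀ {i k} → i < t → k < m → vleaf i + k < n
  leaf<n {i} {k} i<t k<m = s≤s (≤-trans (≤-reflexive (cong suc (+-assoc (t + t) (i * m) k)))
                                 (≤-trans (≤-reflexive (sym (+-suc (t + t) (i * m + k)))) (+-monoʳ-≤ (t + t) (im+k<tm i<t k<m))))

  leaves≤n : ∀ {i} → i < t → vleaf i + m ≤ n
  leaves≤n {i} i<t = ≤-trans (≤-reflexive (cong suc (+-assoc (t + t) (i * m) m)))
                       (s≤s (+-monoʳ-≤ (t + t) (≤-trans (≤-reflexive (+-comm (i * m) m)) (*-monoˡ-≤ m i<t))))

  module Deficits (D : Subset n) where
    c f : ℕ → ℕ
    c = χ D
    f = extend (deficit p G D)

    a b L ℓ : ℕ → ℕ
    a i = c (vy i)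
    b i = c (vx i)
    L i = ∑ℕ m (λ k → c (vleaf i + k))
    ℓ i = ∑ℕ m (λ k → 1 ∸ c (vleaf i + k))

    deficit-y : ∀ i → i < t → (1 ∸ a i) * (p ∸ (c 0 + b i)) ≤ f (vy i)
    deficit-y i i<t = subst (λ s → (1 ∸ a i) * (p ∸ s) ≤ f (vy i))
      (trans (∑ℕ-*-+ n c (ind 0 1) (ind (vx i) 1)) (cong₂ _+_ (∑ℕ-point n 0 c (s≤s z≤n)) (∑ℕ-point n (vx i) c (vx<n i<t))))
      (deficit≥ p G D (vy i) (λ u → ind 0 1 u + ind (vx i) 1 u) (vy<n i<t) within)
      where
      within : ∀ w → toℕ w ≡ vy i → NbhdWithin G w (λ u → ind 0 1 u + ind (vx i) 1 u)
      within w ew j h with nb-y i (toℕ j) i<t (Ft-nbhd-at w j ew h)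
      ... | inj₁ e = in-blocks {0} {1} {vx i} {1} (inj₁ (subst (InBlock 0 1) (sym e) (z≤n , s≤s z≤n)))
      ... | inj₂ e = in-blocks {0} {1} {vx i} {1} (inj₂ (subst (InBlock (vx i) 1) (sym e) (≤-refl , ≤-reflexive (+-comm 1 (vx i)))))

    deficit-x : ∀ i → i < t → (1 ∸ b i) * (p ∸ (a i + L i)) ≤ f (vx i)
    deficit-x i i<t = subst (λ s → (1 ∸ b i) * (p ∸ s) ≤ f (vx i))
      (trans (∑ℕ-*-+ n c (ind (vy i) 1) (ind (vleaf i) m)) (cong₂ _+_ (∑ℕ-point n (vy i) c (vy<n i<t)) (∑ℕ-range n (vleaf i) m c (leaves≤n i<t))))
      (deficit≥ p G D (vx i) (λ u → ind (vy i) 1 u + ind (vleaf i) m u) (vx<n i<t) within)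
      where
      within : ∀ w → toℕ w ≡ vx i → NbhdWithin G w (λ u → ind (vy i) 1 u + ind (vleaf i) m u)
      within w ew j h with nb-x i (toℕ j) i<t (Ft-nbhd-at w j ew h)
      ... | inj₁ e = in-blocks {vy i} {1} {vleaf i} {m} (inj₁ (subst (InBlock (vy i) 1) (sym e) (≤-refl , ≤-reflexive (+-comm 1 (vy i)))))
      ... | inj₂ leaf = in-blocks {vy i} {1} {vleaf i} {m} (inj₂ leaf)

    deficit-leaves : ∀ i → i < t → ℓ i * (p ∸ b i) ≤ ∑ℕ m (λ k → f (vleaf i + k))
    deficit-leaves i i<t = ≤-trans (≤-reflexive (sym (∑ℕ-*ʳ m (p ∸ b i) (λ k → 1 ∸ c (vleaf i + k))))) (∑ℕ-mono m leaf)
      where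
      leaf : ∀ k → k < m → (1 ∸ c (vleaf i + k)) * (p ∸ b i) ≤ f (vleaf i + k)
      leaf k k<m = subst (λ s → (1 ∸ c (vleaf i + k)) * (p ∸ s) ≤ f (vleaf i + k)) (∑ℕ-point n (vx i) c (vx<n i<t))
        (deficit≥ p G D (vleaf i + k) (ind (vx i) 1) (leaf<n i<t k<m) within)
        where
        within : ∀ w → toℕ w ≡ vleaf i + k → NbhdWithin G w (ind (vx i) 1)
        within w ew j h rewrite nb-leaf i k (toℕ j) i<t k<m (Ft-nbhd-at w j ew h) = ≤-reflexive (sym (ind-at (vx i)))

    deficit-branch : ∀ i → i < t →
      branchDeficit m (c 0) (a i) (b i) (ℓ i) (L i) ≤ f (vy i) + f (vx i) + ∑ℕ m (λ k → f (vleaf i + k))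
    deficit-branch i i<t =
      ≤-trans (+-mono-≤ (deficit-y i i<t) (+-mono-≤ (deficit-x i i<t) (deficit-leaves i i<t))) (≤-reflexive (sym (+-assoc (f (vy i)) (f (vx i)) _)))

  Ft-lower : ∀ B D → IsPDom p (G ⊕ B) D → ∣ D ∣ < t + t * m → p + 1 ≤ edgeCount B
  Ft-lower B D dom size = begin
      p + 1
    ≡⟨ +-suc m 1 ⟨
      m + 2
    ≤⟨ Ft-arith t m (c 0) a b ℓ L (s≤s (s≤s z≤n)) (χ≤1 D 0) (λ i _ → χ≤1 D (vy i)) (λ i _ → χ≤1 D (vx i))
                (λ i _ → ∑ℕ-complement m c (χ≤1 D) (vleaf i)) few ⟩
      ∑ℕ t (λ i → branchDeficit m (c 0) (a i) (b i) (ℓ i) (L i))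
    ≤⟨ ∑ℕ-mono t deficit-branch ⟩
      ∑ℕ t (λ i → f (vy i) + f (vx i) + ∑ℕ m (λ k → f (vleaf i + k)))
    ≤⟨ m≤n+m _ (f 0) ⟩
      f 0 + ∑ℕ t (λ i → f (vy i) + f (vx i) + ∑ℕ m (λ k → f (vleaf i + k)))
    ≡⟨ ∑ℕ-Ft f ⟨
      ∑ℕ n f
    ≤⟨ ∑deficit≤edgeCount p G B D dom ⟩
      edgeCount B
    ∎ where
    open ≤-Reasoning
    open Deficits D
    few : c 0 + ∑ℕ t (λ i → a i + b i + L i) < t * suc m
    few = subst₂ _<_ (trans (∣∣≡∑ℕχ D) (∑ℕ-Ft c)) (sym (*-suc t m)) size

  -- The p-dominating set D₀ = {yᵢ} ∪ leaves, of size t·p.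
  inD₀ᵇ : ℕ → Bool
  inD₀ᵇ v = inRange 1 t v ∨ (suc (t + t) ≤ᵇ v)

  D₀ : Subset n
  D₀ = tabulate (λ j → inD₀ᵇ (toℕ j))

  χD₀ : ∀ v → v < n → χ D₀ v ≡ bit (inD₀ᵇ v)
  χD₀ = χ-tabulate inD₀ᵇ

  D₀-y : ∀ i → i < t → χ D₀ (vy i) ≡ 1
  D₀-y i i<t = trans (χD₀ (vy i) (vy<n i<t)) (cong bit (∨-introˡ _ (inRange-intro 1 t (vy i) (s≤s z≤n) i<t)))

  D₀-x : ∀ i → i < t → χ D₀ (vx i) ≡ 0
  D₀-x i i<t = trans (χD₀ (vx i) (vx<n i<t))
    (cong bit (cong₂ _∨_ (inRange-above 1 t (vx i) (t<vx i)) (≤ᵇ-false (suc (t + t)) (vx i) (<⇒≱ (s≤s (vx≤t+t i<t))))))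

  D₀-leaf : ∀ i k → i < t → k < m → χ D₀ (vleaf i + k) ≡ 1
  D₀-leaf i k i<t k<m = trans (χD₀ (vleaf i + k) (leaf<n i<t k<m)) (cong bit (∨-introʳ (inRange 1 t (vleaf i + k)) (≤ᵇ-intro (t+t<leaf i k))))

  ∣D₀∣ : ∣ D₀ ∣ ≡ t + t * m
  ∣D₀∣ = begin
      ∣ D₀ ∣
    ≡⟨ trans (∣∣≡∑ℕχ D₀) (∑ℕ-Ft (χ D₀)) ⟩
      χ D₀ 0 + ∑ℕ t (λ i → χ D₀ (vy i) + χ D₀ (vx i) + ∑ℕ m (λ k → χ D₀ (vleaf i + k)))
    ≡⟨ cong₂ _+_ (χD₀ 0 (s≤s z≤n)) (∑ℕ-cong t branch) ⟩
      ∑ℕ t (λ _ → suc m)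
    ≡⟨ trans (∑ℕ-const t (suc m)) (*-suc t m) ⟩
      t + t * m
    ∎ where
    open ≡-Reasoning
    branch : ∀ i → i < t → χ D₀ (vy i) + χ D₀ (vx i) + ∑ℕ m (λ k → χ D₀ (vleaf i + k)) ≡ suc m
    branch i i<t = cong₂ _+_ (cong₂ _+_ (D₀-y i i<t) (D₀-x i i<t)) (∑ℕ-ones m _ (λ k k<m → D₀-leaf i k i<t k<m))

  not-y-nor-leaf : ∀ a → inRange 1 t a ≡ false → (suc (t + t) ≤ᵇ a) ≡ false → a ≡ 0 ⊎ Σ ℕ (λ i → i < t × a ≡ vx i)
  not-y-nor-leaf zero _ _ = inj₁ refl
  not-y-nor-leaf (suc a) not-y not-leaf with suc a ≤? t | suc a ≤? t + t
  ... | yes a≤t | _ = ⊥-elim (true≢false (inRange-intro 1 t (suc a) (s≤s z≤n) a≤t) not-y)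
  ... | no a≰t | yes a≤t+t = inj₂ (as-vx (suc a) (≤-trans (≤-reflexive t+1≡) (≰⇒> a≰t)) a≤t+t)
  ... | no _ | no a≰t+t = ⊥-elim (true≢false (≤ᵇ-intro (≰⇒> a≰t+t)) not-leaf)

  vy+1≤vleaf : ∀ i → i < t → vy i + 1 ≤ vleaf i
  vy+1≤vleaf i i<t = s≤s (≤-trans (≤-reflexive (+-comm i 1)) (≤-trans i<t (≤-trans (m≤m+n t t) (m≤m+n (t + t) _))))

  1+t≤n : 1 + t ≤ n
  1+t≤n = s≤s (≤-trans (m≤m+n t t) (m≤m+n (t + t) _))

  centre-dominated : ∀ H D w → toℕ w ≡ 0 → (∀ j → adj G w j ≡ true → adj H w j ≡ true) →
    (∀ i → i < t → χ D (vy i) ≡ 1) → p ≤ ∣ D ∩ N H w ∣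
  centre-dominated H D w ew G⊆H ys = ≤-trans p≤t (block-dominates H D w 1 t 1+t≤n (λ j → G⊆H j ∘′ centre-sees w j ew) ys)

  xᵢ-dominated : ∀ H D w i → i < t → toℕ w ≡ vx i → (∀ j → adj G w j ≡ true → adj H w j ≡ true) →
    χ D (vy i) ≡ 1 → (∀ k → k < m → χ D (vleaf i + k) ≡ 1) → p ≤ ∣ D ∩ N H w ∣
  xᵢ-dominated H D w i i<t ew G⊆H y leaves =
    two-blocks-dominate H D w (vy i) 1 (vleaf i) m (vy+1≤vleaf i i<t) (leaves≤n i<t) (λ j → G⊆H j ∘′ xᵢ-sees i w j i<t ew)
      (λ { .0 (s≤s z≤n) → trans (cong (χ D) (+-identityʳ (vy i))) y }) leaves

  D₀-dominates : IsPDom p G D₀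
  D₀-dominates v v∉ with ∨-false (trans (sym (lookup∘tabulate (λ j → inD₀ᵇ (toℕ j)) v)) (∉⇒lookup D₀ v v∉))
  ... | not-y , not-leaf with not-y-nor-leaf (toℕ v) not-y not-leaf
  ...   | inj₁ ev = centre-dominated G D₀ v ev (λ _ h → h) D₀-y
  ...   | inj₂ (i , i<t , ev) = xᵢ-dominated G D₀ v i i<t ev (λ _ h → h) (D₀-y i i<t) (λ k k<m → D₀-leaf i k i<t k<m)

  -- The reinforcing set B₀: join the first leaf L₀ of x₀ to y₀, …, y_{p-1}, and
  -- x₀ to y₁ (p + 1 edges).
  L₀ X₀ : ℕ
  L₀ = vleaf 0
  X₀ = vx 0

  B₀-edgeᵇ : ℕ → ℕ → Bool
  B₀-edgeᵇ a b = ((a ≡ᵇ L₀) ∧ inRange 1 p b) ∨ ((a ≡ᵇ X₀) ∧ (b ≡ᵇ 2))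

  B₀-edge : ℕ → ℕ → Set
  B₀-edge a b = (a ≡ L₀ × InBlock 1 p b) ⊎ (a ≡ X₀ × b ≡ 2)

  B₀-edge-sound : ∀ a b → B₀-edgeᵇ a b ≡ true → B₀-edge a b
  B₀-edge-sound a b h with ∨-true _ _ h
  ... | inj₁ h₁ with ∧-true _ _ h₁
  ...   | x , y with inRange-true 1 p b y
  ...     | lo , hi = inj₁ (≡ᵇ-true a L₀ x , lo , s≤s hi)
  B₀-edge-sound a b h | inj₂ h₂ with ∧-true _ _ h₂
  ... | x , y = inj₂ (≡ᵇ-true a X₀ x , ≡ᵇ-true b 2 y)

  B₀-edge-complete : ∀ a b → B₀-edge a b → B₀-edgeᵇ a b ≡ true
  B₀-edge-complete a b (inj₁ (x , lo , hi)) = ∨-introˡ _ (∧-intro (≡ᵇ-intro a L₀ x) (inRange-intro 1 p b lo (s≤s⁻¹ hi)))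
  B₀-edge-complete a b (inj₂ (x , y)) = ∨-introʳ _ (∧-intro (≡ᵇ-intro a X₀ x) (≡ᵇ-intro b 2 y))

  B₀ : Graph n
  B₀ = fromEdges n B₀-edgeᵇ

  B₀-adj : ∀ i j → adj B₀ i j ≡ true → B₀-edge (toℕ i) (toℕ j) ⊎ B₀-edge (toℕ j) (toℕ i)
  B₀-adj i j h with fromEdges-adj n B₀-edgeᵇ i j h
  ... | inj₁ e = inj₁ (B₀-edge-sound (toℕ i) (toℕ j) e)
  ... | inj₂ e = inj₂ (B₀-edge-sound (toℕ j) (toℕ i) e)

  B₀-nbhd-at : ∀ {a} w j → toℕ w ≡ a → adj B₀ w j ≡ true → B₀-edge a (toℕ j) ⊎ B₀-edge (toℕ j) a
  B₀-nbhd-at w j refl h = B₀-adj w j h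

  B₀-adj-intro : ∀ i j → toℕ i ≢ toℕ j → B₀-edge (toℕ i) (toℕ j) → adj B₀ i j ≡ true
  B₀-adj-intro i j ne e = fromEdges-intro n B₀-edgeᵇ i j ne (inj₁ (B₀-edge-complete _ _ e))

  3≤t : 3 ≤ t
  3≤t = ≤-trans (s≤s (s≤s (s≤s z≤n))) p≤t

  p<X₀ : p < X₀
  p<X₀ = s≤s (≤-trans p≤t (m≤m+n t 0))

  X₀<L₀ : X₀ < L₀
  X₀<L₀ = s≤s (≤-trans (≤-reflexive (trans (cong suc (+-identityʳ t)) (sym t+1≡)))
                      (≤-trans (+-monoʳ-≤ t (≤-trans (s≤s z≤n) 3≤t)) (m≤m+n (t + t) 0)))

  2<X₀ : 2 < X₀
  2<X₀ = ≤-trans (s≤s (s≤s (s≤s z≤n))) p<X₀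

  0<t : 0 < t
  0<t = ≤-trans (s≤s z≤n) 3≤t

  L₀<n : L₀ < n
  L₀<n = subst (_< n) (+-identityʳ L₀) (leaf<n {0} {0} 0<t (s≤s z≤n))

  nbB₀-L₀ : ∀ b → B₀-edge L₀ b ⊎ B₀-edge b L₀ → InBlock 1 p b
  nbB₀-L₀ b (inj₁ (inj₁ (_ , block))) = block
  nbB₀-L₀ b (inj₁ (inj₂ (e , _))) = ⊥-elim (<-irrefl (sym e) X₀<L₀)
  nbB₀-L₀ b (inj₂ (inj₁ (_ , _ , L₀<1+p))) = ⊥-elim (≤⇒≯ (s≤s⁻¹ L₀<1+p) (<-trans p<X₀ X₀<L₀))
  nbB₀-L₀ b (inj₂ (inj₂ (_ , e))) = ⊥-elim (<-irrefl (sym e) (<-trans 2<X₀ X₀<L₀))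

  nbB₀-X₀ : ∀ b → B₀-edge X₀ b ⊎ B₀-edge b X₀ → b ≡ 2
  nbB₀-X₀ b (inj₁ (inj₁ (e , _))) = ⊥-elim (<-irrefl e X₀<L₀)
  nbB₀-X₀ b (inj₁ (inj₂ (_ , e))) = e
  nbB₀-X₀ b (inj₂ (inj₁ (_ , _ , X₀<1+p))) = ⊥-elim (≤⇒≯ (s≤s⁻¹ X₀<1+p) p<X₀)
  nbB₀-X₀ b (inj₂ (inj₂ (_ , e))) = ⊥-elim (<-irrefl (sym e) 2<X₀)

  B₀-edge-source : ∀ {a b} → B₀-edge a b → a ≡ L₀ ⊎ a ≡ X₀
  B₀-edge-source (inj₁ (e , _)) = inj₁ e
  B₀-edge-source (inj₂ (e , _)) = inj₂ e

  B₀-touches : ∀ i j → adj B₀ i j ≡ true → Touches L₀ X₀ i ⊎ Touches L₀ X₀ j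
  B₀-touches i j h with B₀-adj i j h
  ... | inj₁ e = inj₁ (B₀-edge-source e)
  ... | inj₂ e = inj₂ (B₀-edge-source e)

  -- |E(B₀)| ≤ deg(L₀) + deg(X₀) = p + 1
  ∣B₀∣≤ : edgeCount B₀ ≤ p + 1
  ∣B₀∣≤ = ≤-trans
    (edgeCount≤two-stars B₀ L₀ X₀ (ind 1 p) (ind 2 1) L₀<n (vx<n 0<t) B₀-touches
       (λ w ew j h → in-block (nbB₀-L₀ (toℕ j) (B₀-nbhd-at w j ew h)))
       (λ w ew j h → ≤-reflexive (sym (trans (cong (ind 2 1) (nbB₀-X₀ (toℕ j) (B₀-nbhd-at w j ew h))) (ind-at 2)))))
    (≤-reflexive (cong₂ _+_ (∑ℕ-ind n 1 p (≤-trans (s≤s p≤t) 1+t≤n)) (∑ℕ-ind n 2 1 (<-trans 2<X₀ (<-trans X₀<L₀ L₀<n)))))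

  B₀-new-edges : ∀ a b → B₀-edge a b → Ft-edge a b ⊎ Ft-edge b a → ⊥
  B₀-new-edges a b (inj₁ (refl , _ , b<1+p)) f with nb-leaf 0 0 b 0<t (s≤s z≤n) (subst (λ v → Ft-edge v b ⊎ Ft-edge b v) (sym (+-identityʳ L₀)) f)
  ... | refl = ≤⇒≯ (s≤s⁻¹ b<1+p) p<X₀
  B₀-new-edges a b (inj₂ (refl , refl)) f with nb-x 0 2 0<t f
  ... | inj₁ ()
  ... | inj₂ (L₀≤2 , _) = ≤⇒≯ L₀≤2 (<-trans 2<X₀ X₀<L₀)

  B₀∩G=∅ : Disjoint B₀ G
  B₀∩G=∅ i j h = ¬-not (λ g → either (B₀-adj i j h) (Ft-adj i j g))
    where
    either : B₀-edge (toℕ i) (toℕ j) ⊎ B₀-edge (toℕ j) (toℕ i) → Ft-edge (toℕ i) (toℕ j) ⊎ Ft-edge (toℕ j) (toℕ i) → ⊥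
    either (inj₁ e) f = B₀-new-edges _ _ e f
    either (inj₂ e) f = B₀-new-edges _ _ e (swap f)

  -- D₁ = D₀ minus L₀ p-dominates G ⊕ B₀ and has fewer than t·p vertices.
  GB₀ : Graph n
  GB₀ = G ⊕ B₀

  via-G : ∀ w j → adj G w j ≡ true → adj GB₀ w j ≡ true
  via-G w j h = ∨-introˡ (adj B₀ w j) h

  via-B₀ : ∀ w j → adj B₀ w j ≡ true → adj GB₀ w j ≡ true
  via-B₀ w j h = ∨-introʳ (adj G w j) h

  inD₁ᵇ : ℕ → Bool
  inD₁ᵇ v = inRange 1 t v ∨ (suc L₀ ≤ᵇ v)

  D₁ : Subset n
  D₁ = tabulate (λ j → inD₁ᵇ (toℕ j))

  χD₁ : ∀ v → v < n → χ D₁ v ≡ bit (inD₁ᵇ v)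
  χD₁ = χ-tabulate inD₁ᵇ

  D₁-y : ∀ i → i < t → χ D₁ (vy i) ≡ 1
  D₁-y i i<t = trans (χD₁ (vy i) (vy<n i<t)) (cong bit (∨-introˡ _ (inRange-intro 1 t (vy i) (s≤s z≤n) i<t)))

  D₁-above-L₀ : ∀ v → L₀ < v → v < n → χ D₁ v ≡ 1
  D₁-above-L₀ v L₀<v v<n = trans (χD₁ v v<n) (cong bit (∨-introʳ (inRange 1 t v) (≤ᵇ-intro L₀<v)))

  ∣D₁∣<γ : ∣ D₁ ∣ < t + t * m
  ∣D₁∣<γ = begin-strict
      ∣ D₁ ∣          ≡⟨ ∣∣≡∑ℕχ D₁ ⟩
      ∑ℕ n (χ D₁)     <⟨ ∑ℕ-mono-< n L₀ D₁⊆D₀ L₀<n L₀∉D₁ ⟩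
      ∑ℕ n (χ D₀)     ≡⟨ trans (sym (∣∣≡∑ℕχ D₀)) ∣D₀∣ ⟩
      t + t * m       ∎
    where
    open ≤-Reasoning
    D₁⊆D₀ : ∀ v → v < n → χ D₁ v ≤ χ D₀ v
    D₁⊆D₀ v v<n = subst₂ _≤_ (sym (χD₁ v v<n)) (sym (χD₀ v v<n)) (bit-mono in-D₀)
      where
      in-D₀ : inD₁ᵇ v ≡ true → inD₀ᵇ v ≡ true
      in-D₀ h with ∨-true (inRange 1 t v) _ h
      ... | inj₁ y = ∨-introˡ _ y
      ... | inj₂ above = ∨-introʳ (inRange 1 t v) (≤ᵇ-intro (≤-trans (s≤s (m≤m+n (t + t) 0)) (<⇒≤ (≤ᵇ-true (suc L₀) v above))))
    L₀∉D₁ : χ D₁ L₀ < χ D₀ L₀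
    L₀∉D₁ = subst₂ _<_ (sym (trans (χD₁ L₀ L₀<n) (cong bit (cong₂ _∨_ (inRange-above 1 t L₀ (<-trans (t<vx 0) X₀<L₀))
                                                                    (≤ᵇ-false (suc L₀) L₀ (<-irrefl refl))))))
                       (sym (trans (cong (χ D₀) (sym (+-identityʳ L₀))) (D₀-leaf 0 0 0<t (s≤s z≤n))))
                       (s≤s z≤n)

  outside-D₁ : ∀ a → inD₁ᵇ a ≡ false → a ≡ 0 ⊎ Σ ℕ (λ i → i < t × a ≡ vx i) ⊎ a ≡ L₀
  outside-D₁ a h with ∨-false {inRange 1 t a} h
  ... | not-y , not-above with suc (t + t) ≤? a
  ...   | no a≱ with not-y-nor-leaf a not-y (≤ᵇ-false _ _ a≱)
  ...     | inj₁ centre = inj₁ centre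
  ...     | inj₂ xᵢ = inj₂ (inj₁ xᵢ)
  outside-D₁ a h | not-y , not-above | yes a≥ =
    inj₂ (inj₂ (≤-antisym (≮⇒≥ (λ L₀<a → true≢false (≤ᵇ-intro L₀<a) not-above)) (≤-trans (s≤s (≤-reflexive (+-identityʳ (t + t)))) a≥)))

  one-or-two : ∀ {v} → InBlock 1 2 v → v ≡ 1 ⊎ v ≡ 2
  one-or-two (s≤s z≤n , s≤s (s≤s z≤n)) = inj₁ refl
  one-or-two (s≤s z≤n , s≤s (s≤s (s≤s z≤n))) = inj₂ refl

  -- x₀ sees y₀, through B₀ also y₁, and its leaves other than L₀
  x₀-in-GB₀ : ∀ w j → toℕ w ≡ X₀ → InBlock 1 2 (toℕ j) ⊎ InBlock (suc L₀) (suc q) (toℕ j) → adj GB₀ w j ≡ true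
  x₀-in-GB₀ w j ew (inj₁ y₀y₁) with one-or-two y₀y₁
  ... | inj₁ e₁ = via-G w j (xᵢ-sees-yᵢ 0 w j 0<t ew e₁)
  ... | inj₂ e₂ = via-B₀ w j (B₀-adj-intro w j (≢-via ew e₂ (λ e → <-irrefl (sym e) 2<X₀)) (inj₂ (ew , e₂)))
  x₀-in-GB₀ w j ew (inj₂ (lo≤ , <hi)) =
    via-G w j (xᵢ-sees-leaves 0 w j 0<t ew (≤-trans (n≤1+n L₀) lo≤ , ≤-trans <hi (≤-reflexive (sym (+-suc L₀ (suc q))))))

  -- L₀ sees, through B₀, the vertices y₀, …, y_{p-1}
  L₀-in-GB₀ : ∀ w j → toℕ w ≡ L₀ → InBlock 1 p (toℕ j) → adj GB₀ w j ≡ true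
  L₀-in-GB₀ w j ew block = via-B₀ w j (B₀-adj-intro w j (λ e → ≤⇒≯ (s≤s⁻¹ (proj₂ block)) (subst (p <_) (trans (sym ew) e) (<-trans p<X₀ X₀<L₀)))
                                         (inj₁ (ew , block)))

  D₁-dominates : IsPDom p GB₀ D₁
  D₁-dominates v v∉ with outside-D₁ (toℕ v) (trans (sym (lookup∘tabulate (λ j → inD₁ᵇ (toℕ j)) v)) (∉⇒lookup D₁ v v∉))
  ... | inj₁ ev = centre-dominated GB₀ D₁ v ev (via-G v) D₁-y
  ... | inj₂ (inj₁ (suc i , i<t , ev)) = xᵢ-dominated GB₀ D₁ v (suc i) i<t ev (via-G v) (D₁-y (suc i) i<t)
          (λ k k<m → D₁-above-L₀ _ (s≤s (≤-trans (≤-reflexive (trans (cong suc (+-identityʳ (t + t))) (+-comm 1 (t + t))))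
                                              (≤-trans (+-monoʳ-≤ (t + t) (s≤s z≤n)) (m≤m+n _ k)))) (leaf<n i<t k<m))
  ... | inj₂ (inj₁ (zero , _ , ev)) = two-blocks-dominate GB₀ D₁ v 1 2 (suc L₀) (suc q)
          (s≤s (s≤s (≤-trans 0<t (≤-trans (m≤m+n t t) (m≤m+n (t + t) 0))))) (≤-trans (≤-reflexive (sym (+-suc L₀ (suc q)))) (leaves≤n 0<t))
          (λ j → x₀-in-GB₀ v j ev)
          (λ k k<2 → D₁-y k (≤-trans k<2 (≤-trans (s≤s (s≤s z≤n)) 3≤t)))
          (λ k k<q → D₁-above-L₀ (suc L₀ + k) (s≤s (m≤m+n L₀ k))
                       (subst (_< n) (+-suc L₀ k) (leaf<n {0} {suc k} 0<t (s≤s k<q))))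
  ... | inj₂ (inj₂ ev) = block-dominates GB₀ D₁ v 1 p (≤-trans (s≤s p≤t) 1+t≤n) (λ j → L₀-in-GB₀ v j ev)
          (λ k k<p → D₁-y k (≤-trans k<p p≤t))

  Ft-rp : IsRP p G (p + 1)
  Ft-rp = rp-from-bounds p G (t + t * m) (p + 1) p<γ (s≤s z≤n) (D₀ , D₀-dominates , ∣D₀∣)
            Ft-lower B₀ B₀∩G=∅ ∣B₀∣≤ (D₁ , D₁-dominates , ∣D₁∣<γ)
    where
    p<γ : p < t + t * m
    p<γ = ≤-trans (s≤s p≤t) (≤-trans (≤-reflexive (+-comm 1 t)) (+-monoʳ-≤ t (*-mono-≤ 0<t (s≤s (z≤n {suc q})))))

lemma4p1 : (p : ℕ) → 3 ≤ p →
    IsRP p (F p) (p + 1) × ((t : ℕ) → p ≤ t → IsRP p (Ft t p) (p + 1))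
lemma4p1 .(3 + q) (s≤s (s≤s (s≤s (z≤n {q})))) = F-tree.F-rp q , λ t p≤t → Ft-tree.Ft-rp q t p≤t
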